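{- Let $\mathcal{L}\in\{\mathtt{M},\mathtt{ME}^\infty\}$, let $B\subseteq A$ and let $\phi$ be a sentence of $\mathcal{L}(A)$. Then $\phi$ is continuous in $B$ if and only if $\phi$ is equivalent to some syntactically $B$-continuous sentence of $\mathcal{L}(A)$. Furthermore, it is decidable whether a given sentence $\phi\in\mathcal{L}(A)$ is continuous in $B$.
   Context: Fix a finite set $A$ of monadic predicate symbols. A monadic model is a pair $(D,V)$ with $D$ a set (the empty set is allowed) and $V:A\to\wp(D)$. Formulas of $\mathtt{ME}^\infty(A)$ are given by the grammar $\varphi::=\top\mid\bot\mid a(x)\mid\neg a(x)\mid x\approx y\mid x\not\approx y\mid\varphi\vee\varphi\mid\varphi\wedge\varphi\mid\exists x.\varphi\mid\forall x.\varphi\mid\exists^\infty x.\varphi\mid\forall^\infty x.\varphi$ with $a\in A$ and $x,y$ individual variables. $\mathtt{M}(A)$ is the fragment without $\exists^\infty,\forall^\infty,\approx,\not\approx$. A sentence is a formula without free variables. On a nonempty model truth under an assignment is standard, where $\exists^\infty x.\varphi$ holds iff infinitely many elements satisfy $\varphi$ and $\forall^\infty x.\varphi$ holds iff all but at most finitely many elements satisfy $\varphi$. On the empty model, $\exists x.\varphi,\exists^\infty x.\varphi$ are false, $\forall x.\varphi,\forall^\infty x.\varphi$ true, Boolean connectives as usual. Sentences are equivalent if true in exactly the same models. For valuations $U,V$ on the same domain, $U\le_B V$ means $U(b)\subseteq V(b)$ for $b\in B$ and $U(a)=V(a)$ for $a\in A\setminus B$; $U\le^\omega_B V$ means $U\le_B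 V$ and $U(b)$ is finite for every $b\in B$. A formula $\phi$ is monotone in $B$ if $(D,V),g\models\phi$ and $V\le_B V'$ imply $(D,V'),g\models\phi$; it is continuous in $B$ if it is monotone in $B$ and whenever $(D,V),g\models\phi$ there is $U\le^\omega_B V$ with $(D,U),g\models\phi$ (for all models and assignments $g$). Syntactically $B$-continuous formulas of $\mathtt{M}(A)$: $\phi::=\psi\mid b(x)\mid\phi\wedge\phi\mid\phi\vee\phi\mid\exists x.\phi$ with $b\in B$, $\psi\in\mathtt{M}(A\setminus B)$. For $\mathtt{ME}^\infty$, define $\mathbf{W}x.(\phi,\psi):=\forall x.(\phi(x)\vee\psi(x))\wedge\forall^\infty x.\psi(x)$; syntactically $B$-continuous formulas of $\mathtt{ME}^\infty(A)$: $\phi::=\psi\mid b(x)\mid\phi\wedge\phi\mid\phi\vee\phi\mid\exists x.\phi\mid\mathbf{W}x.(\phi,\psi)$ with $b\in B$, $\psi\in\mathtt{ME}^\infty(A\setminus B)$. -}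

module Defs where

open import Level using (0ℓ) renaming (suc to lsuc)
open import Data.Nat using (ℕ; suc)
open import Data.Fin using (Fin; zero; suc)
open import Data.Fin.Subset using (Subset; _∈_; _∉_)
open import Data.Bool using (Bool)
open import Data.Unit using (⊤; tt)
open import Data.Empty using (⊥)
open import Data.List using (List)
import Data.List.Membership.Propositional as LMem
open import Data.Product using (Σ; ∃; _×_; _,_)
open import Data.Sum using (_⊎_)
open import Relation.Nullary using (¬_)
open import Relation.Binary.PropositionalEquality using (_≡_)
open import Function.Bundles using (_⇔_)
open import Axiom.ExcludedMiddle using (ExcludedMiddle)

data Lang : Set where
  M MEinf : Lang

IsMEinf : Lang → Set
IsMEinf M = ⊥
IsMEinf MEinf = ⊤

-- Formulas of L(A) with A = Fin k, with n free variables (de Bruijn, Fin n).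
-- Quantifiers bind variable zero of the body.
data Fm (L : Lang) (k : ℕ) : ℕ → Set where
  tt′ ff′   : ∀ {n} → Fm L k n
  atom     : ∀ {n} → Fin k → Fin n → Fm L k n
  natom    : ∀ {n} → Fin k → Fin n → Fm L k n
  eq neq   : ∀ {n} → IsMEinf L → Fin n → Fin n → Fm L k n
  or and   : ∀ {n} → Fm L k n → Fm L k n → Fm L k n
  ex all   : ∀ {n} → Fm L k (suc n) → Fm L k n
  exInf allInf : ∀ {n} → IsMEinf L → Fm L k (suc n) → Fm L k n

Sentence : Lang → ℕ → Set
Sentence L k = Fm L k 0

-- Valuations on a domain D (any type, possibly empty).
Val : ℕ → Set → Set₁
Val k D = Fin k → D → Set

Finite : {D : Set} → (D → Set) → Set
Finite {D} P = Σ (List D) λ xs → ∀ d → P d → LMem._∈_ d xs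

extend : ∀ {D : Set} {n} → D → (Fin n → D) → Fin (suc n) → D
extend d g zero = d
extend d g (suc i) = g i

Sat : ∀ {L k n} (D : Set) → Val k D → Fm L k n → (Fin n → D) → Set
Sat D V tt′ g = ⊤
Sat D V ff′ g = ⊥
Sat D V (atom a x) g = V a (g x)
Sat D V (natom a x) g = ¬ V a (g x)
Sat D V (eq _ x y) g = g x ≡ g y
Sat D V (neq _ x y) g = ¬ (g x ≡ g y)
Sat D V (or φ ψ) g = Sat D V φ g ⊎ Sat D V ψ g
Sat D V (and φ ψ) g = Sat D V φ g × Sat D V ψ g
Sat D V (ex φ) g = Σ D λ d → Sat D V φ (extend d g)
Sat D V (all φ) g = (d : D) → Sat D V φ (extend d g)
Sat D V (exInf _ φ) g = ¬ Finite (λ d → Sat D V φ (extend d g))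
Sat D V (allInf _ φ) g = Finite (λ d → ¬ Sat D V φ (extend d g))

noVars : {D : Set} → Fin 0 → D
noVars ()

_≤[_]_ : ∀ {k} {D : Set} → Val k D → Subset k → Val k D → Set
U ≤[ B ] V = ∀ a → (a ∈ B → ∀ d → U a d → V a d)
                 × (a ∉ B → ∀ d → U a d ⇔ V a d)

_≤ω[_]_ : ∀ {k} {D : Set} → Val k D → Subset k → Val k D → Set
U ≤ω[ B ] V = U ≤[ B ] V × (∀ b → b ∈ B → Finite (U b))

Monotone : ∀ {L k n} → Subset k → Fm L k n → Set₁
Monotone {k = k} {n} B φ = ∀ (D : Set) (V V′ : Val k D) (g : Fin n → D) →
  Sat D V φ g → V ≤[ B ] V′ → Sat D V′ φ g

Continuous : ∀ {L k n} → Subset k → Fm L k n → Set₁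
Continuous {k = k} {n} B φ = Monotone B φ ×
  (∀ (D : Set) (V : Val k D) (g : Fin n → D) → Sat D V φ g →
     Σ (Val k D) λ U → U ≤ω[ B ] V × Sat D U φ g)

Equivalent : ∀ {L k} → Sentence L k → Sentence L k → Set₁
Equivalent {k = k} φ ψ = ∀ (D : Set) (V : Val k D) →
  Sat D V φ noVars ⇔ Sat D V ψ noVars

-- ψ ∈ L(A \ B): a formula of L(A) using no predicate letter from B.
data NoB {L k} (B : Subset k) : ∀ {n} → Fm L k n → Set where
  tt′ : ∀ {n} → NoB B (tt′ {n = n})
  ff′ : ∀ {n} → NoB B (ff′ {n = n})
  atom : ∀ {n} {a} {x : Fin n} → a ∉ B → NoB B (atom a x)
  natom : ∀ {n} {a} {x : Fin n} → a ∉ B → NoB B (natom a x)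
  eq : ∀ {n} p (x y : Fin n) → NoB B (eq p x y)
  neq : ∀ {n} p (x y : Fin n) → NoB B (neq p x y)
  or : ∀ {n} {φ ψ : Fm L k n} → NoB B φ → NoB B ψ → NoB B (or φ ψ)
  and : ∀ {n} {φ ψ : Fm L k n} → NoB B φ → NoB B ψ → NoB B (and φ ψ)
  ex : ∀ {n} {φ : Fm L k (suc n)} → NoB B φ → NoB B (ex φ)
  all : ∀ {n} {φ : Fm L k (suc n)} → NoB B φ → NoB B (all φ)
  exInf : ∀ {n} p {φ : Fm L k (suc n)} → NoB B φ → NoB B (exInf p φ)
  allInf : ∀ {n} p {φ : Fm L k (suc n)} → NoB B φ → NoB B (allInf p φ)

W : ∀ {L k n} → IsMEinf L → Fm L k (suc n) → Fm L k (suc n) → Fm L k n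
W p φ ψ = and (all (or φ ψ)) (allInf p ψ)

-- Syntactically B-continuous formulas of L(A).
-- The W clause requires IsMEinf L, so for L = M it is the M-grammar.
data SynCont {L k} (B : Subset k) : ∀ {n} → Fm L k n → Set where
  base : ∀ {n} {ψ : Fm L k n} → NoB B ψ → SynCont B ψ
  atom : ∀ {n} {b} {x : Fin n} → b ∈ B → SynCont B (atom b x)
  and : ∀ {n} {φ ψ : Fm L k n} → SynCont B φ → SynCont B ψ → SynCont B (and φ ψ)
  or : ∀ {n} {φ ψ : Fm L k n} → SynCont B φ → SynCont B ψ → SynCont B (or φ ψ)
  ex : ∀ {n} {φ : Fm L k (suc n)} → SynCont B φ → SynCont B (ex φ)
  w : ∀ {n} p {φ ψ : Fm L k (suc n)} → SynCont B φ → NoB B ψ → SynCont B (W p φ ψ)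

-- Classical metatheory: excluded middle (for Set₁-propositions; Set-propositions lift).
LEM : Set₂
LEM = ExcludedMiddle (lsuc 0ℓ)

-- Whether a formula of quantifier depth ≤ N holds under an assignment depends only on its profile:
-- the colours (sets of true predicates) of the assigned elements and, for every colour, how many
-- other elements carry it, counted up to N with ∞ kept apart. Profiles are finite data, so truth on
-- them is computable, and enumerating the finitely many truncated colour counts decides equivalence.
--
-- For every admissible colour count π there is a syntactically B-continuous sentence χ π that holds
-- in V exactly when some U ≤ω V has colour counts π. Let Ψ φ be the disjunction of the χ π over the
-- π at which φ holds. A monotone φ follows from Ψ φ (pass to such a U, which satisfies φ, and go back
-- up by monotonicity), and a continuous φ implies Ψ φ (continuity gives U ≤ω V satisfying φ, whose
-- counts π then make χ π true in V). So φ is continuous iff it is equivalent to Ψ φ, which is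
-- decidable. Without equality and ∞-quantifiers only the set of realised colours matters, and the
-- same scheme runs through bisimulations.

module Submission where

open import Defs
open import Level using (Lift; lift)
open import Data.Nat using (ℕ; zero; suc; _+_; _≤_; _<_; z≤n; s≤s; _⊓_; _⊔_; pred; _<ᵇ_; _≡ᵇ_)
open import Data.Nat.Properties using (≤-refl; ≤-trans; ≤-pred; _≤?_; ≰⇒>; n≤1+n; <-irrefl; <-irrelevant;
  m≤m⊔n; m≤n⊔m; m≤n⇒m≤n⊔o; m≤n⇒m≤o⊔n; ⊓-idem; ⊓-monoʳ-≤; m⊓n≤m; m≤n⇒m⊓n≡m; m⊔n≤o⇒m≤o; m⊔n≤o⇒n≤o; ≡ᵇ⇒≡;
  ≡⇒≡ᵇ; <ᵇ⇒<; <⇒<ᵇ; m≤n⇒m<n∨m≡n)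
open import Data.Fin as F using (Fin; zero; suc; punchIn)
open import Data.Fin.Properties using (suc-injective; splitAt-↑ˡ; splitAt-↑ʳ; join-splitAt;
  punchIn-injective; punchInᵢ≢i; injective⇒≤; inject≤-injective; toℕ<n; toℕ-fromℕ<; toℕ-injective)
open import Data.Fin.Subset using (Subset; _∉_) renaming (_∈_ to _∈s_)
open import Data.Bool using (Bool; true; false; T; _∧_; _∨_; not; if_then_else_)
import Data.Bool
open import Data.Bool.Properties using (T-∧; T-∨; T-≡; T-irrelevant; T?)
open import Data.Vec as V using (Vec; []; _∷_; lookup)
import Data.Vec.Properties as VP
open import Data.List as L using (List; []; _∷_; length)
open import Data.List.Relation.Unary.Any as Any using (Any; here; there)
open import Data.List.Relation.Unary.Any.Properties using (lookup-index; any⁺; any⁻)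
open import Data.List.Relation.Unary.All as All using (All)
open import Data.List.Relation.Unary.All.Properties using (all⁺; all⁻)
open import Data.Bool.ListAction using () renaming (any to anyᵇ; all to allᵇ)
open import Data.List.Membership.Propositional using (_∈_; find)
open import Data.List.Properties using (length-map; length-tabulate)
open import Data.List.Membership.Propositional.Properties
  using (∈-allFin; ∈-map⁺; ∈-map⁻; ∈-++⁺ˡ; ∈-++⁺ʳ; ∈-concat⁺′; ∈-concatMap⁻)
open import Data.Product using (Σ; _×_; _,_; proj₁; proj₂; uncurry)
open import Data.Sum using (_⊎_; inj₁; inj₂)
open import Data.Empty using (⊥-elim)
open import Data.Unit using (⊤; tt)
open import Data.Maybe using (Maybe; just; nothing)
open import Relation.Nullary using (¬_; Dec; yes; no; does)
open import Relation.Nullary.Decidable using (decidable-stable; isYes; toWitness; fromWitness)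
open import Data.Sum.Function.Propositional using (_⊎-⇔_)
open import Data.Product.Function.NonDependent.Propositional using (_×-⇔_)
import Function.Properties.Equivalence as ⇔
open import Relation.Binary.PropositionalEquality
open import Relation.Binary.Definitions using (DecidableEquality)
open import Function using (id; _∘_; case_of_)
open import Function.Definitions using (Injective)
open import Function.Bundles using (_⇔_; mk⇔; Equivalence)
open Equivalence using (to; from)

module Classical (lem : LEM) where

  decide : (P : Set) → Dec P
  decide P with lem {Lift _ P}
  ... | yes (lift p) = yes p
  ... | no ¬p = no (¬p ∘ lift)

  ¬¬-elim : {P : Set} → ¬ ¬ P → P
  ¬¬-elim {P} = decidable-stable (decide P)

  _≟_ : {D : Set} → DecidableEquality D
  x ≟ y = decide (x ≡ y)

T-not : ∀ {x} → T (not x) ⇔ (¬ T x)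
T-not {false} = mk⇔ (λ _ ()) _
T-not {true} = mk⇔ (λ ()) (λ ¬t → ¬t tt)

T-⇒ : ∀ {x y} → T (not x ∨ y) ⇔ (T x → T y)
T-⇒ {false} = mk⇔ (λ _ ()) _
T-⇒ {true} = mk⇔ (λ t _ → t) (λ f → f tt)

¬-cong : {A B : Set} → A ⇔ B → (¬ A) ⇔ (¬ B)
¬-cong A⇔B = mk⇔ (λ ¬a b → ¬a (from A⇔B b)) (λ ¬b a → ¬b (to A⇔B a))

module _ {A : Set} {xs : List A} (complete : ∀ x → x ∈ xs) (p : A → Bool) where

  T-any-complete : T (anyᵇ p xs) ⇔ Σ A (T ∘ p)
  T-any-complete = mk⇔ (Any.satisfied ∘ any⁻ p xs)
                       (λ (x , px) → any⁺ p (Any.map (λ { refl → px }) (complete x)))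

  T-all-complete : T (allᵇ p xs) ⇔ (∀ x → T (p x))
  T-all-complete = mk⇔ (λ t x → All.lookup (all⁺ p xs t) (complete x))
                       (λ f → all⁻ p {xs} (All.tabulate λ {x} _ → f x))

T⇔⇒≡ : ∀ {x y} → (T x → T y) → (T y → T x) → x ≡ y
T⇔⇒≡ {false} {false} _ _ = refl
T⇔⇒≡ {false} {true} _ y⇒x = ⊥-elim (y⇒x tt)
T⇔⇒≡ {true} {false} x⇒y _ = ⊥-elim (x⇒y tt)
T⇔⇒≡ {true} {true} _ _ = refl

-- Finite sets and counting

module _ {D : Set} where

  Finite-⊆ : {P Q : D → Set} → (∀ d → P d → Q d) → Finite Q → Finite P
  Finite-⊆ P⊆Q (xs , Q⊆xs) = xs , λ d → Q⊆xs d ∘ P⊆Q d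

  Finite-∪ : {P Q : D → Set} → Finite P → Finite Q → Finite (λ d → P d ⊎ Q d)
  Finite-∪ (xs , P⊆xs) (ys , Q⊆ys) = xs L.++ ys , λ
    { d (inj₁ p) → ∈-++⁺ˡ (P⊆xs d p)
    ; d (inj₂ q) → ∈-++⁺ʳ xs (Q⊆ys d q) }

  Finite-⋃ : {C : Set} {Q : C → D → Set} (cs : List C) → (∀ c → Finite (Q c)) →
             Finite (λ d → Σ C λ c → c ∈ cs × Q c d)
  Finite-⋃ [] fin = [] , λ { d (_ , () , _) }
  Finite-⋃ {C} {Q} (c ∷ cs) fin = Finite-⊆ split (Finite-∪ (fin c) (Finite-⋃ {Q = Q} cs fin))
    where
      split : ∀ d → Σ C (λ c′ → c′ ∈ c ∷ cs × Q c′ d) → Q c d ⊎ Σ C λ c′ → c′ ∈ cs × Q c′ d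
      split d (_ , here refl , q) = inj₁ q
      split d (c′ , there c′∈cs , q) = inj₂ (c′ , c′∈cs , q)

  Finite-range : ∀ {m} (f : Fin m → D) → Finite (λ d → Σ (Fin m) λ i → f i ≡ d)
  Finite-range {m} f = L.map f (L.allFin m) , λ { d (i , refl) → ∈-map⁺ f (∈-allFin i) }

  record AtLeast (P : D → Set) (n : ℕ) : Set where
    constructor distinct
    field
      elem : Fin n → D
      elem-injective : Injective _≡_ _≡_ elem
      elem-satisfies : ∀ i → P (elem i)

  AtMost : (D → Set) → ℕ → Set
  AtMost P m = ∀ {n} → AtLeast P n → n ≤ m

  AtLeast-zero : {P : D → Set} → AtLeast P 0
  AtLeast-zero = distinct (λ ()) (λ { {()} }) (λ ())

  AtMost-length : {P : D → Set} ((xs , _) : Finite P) → AtMost P (length xs)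
  AtMost-length (xs , P⊆xs) (distinct f f-inj Pf) = injective⇒≤ position-injective
    where
      position : ∀ i → Fin (length xs)
      position i = Any.index (P⊆xs (f i) (Pf i))
      position-injective : Injective _≡_ _≡_ position
      position-injective {i} {j} same = f-inj (begin
        f i                                  ≡⟨ lookup-index (P⊆xs (f i) (Pf i)) ⟩
        L.lookup xs (position i)             ≡⟨ cong (L.lookup xs) same ⟩
        L.lookup xs (position j)             ≡⟨ lookup-index (P⊆xs (f j) (Pf j)) ⟨
        f j                                  ∎)
        where open ≡-Reasoning

  AtMost-range : ∀ {P : D → Set} {m} (h : Fin m → D) → (∀ d → P d → Σ (Fin m) λ t → h t ≡ d) →
                 AtMost P m
  AtMost-range {m = m} h cover atLeast =
    subst (_ ≤_) (trans (length-map h (L.allFin m)) (length-tabulate _))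
                 (AtMost-length (Finite-⊆ cover (Finite-range h)) atLeast)

  ¬Finite-if-unbounded : {P : D → Set} → (∀ n → AtLeast P n) → ¬ Finite P
  ¬Finite-if-unbounded unbounded finite =
    <-irrefl refl (AtMost-length finite (unbounded (suc (length (proj₁ finite)))))

  AtLeast-≤ : {P : D → Set} {m n : ℕ} → m ≤ n → AtLeast P n → AtLeast P m
  AtLeast-≤ m≤n (distinct f f-inj Pf) =
    distinct (λ i → f (F.inject≤ i m≤n)) (λ same → inject≤-injective m≤n m≤n _ _ (f-inj same))
             (λ i → Pf (F.inject≤ i m≤n))

  ¬AtLeast⇒AtMost : {P : D → Set} {m : ℕ} → ¬ AtLeast P (suc m) → AtMost P m
  ¬AtLeast⇒AtMost {P} {m} ¬more {n} atLeast with n ≤? m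
  ... | yes n≤m = n≤m
  ... | no n≰m = ⊥-elim (¬more (AtLeast-≤ {P} (≰⇒> n≰m) atLeast))

  extend-injective : ∀ {n} {d : D} {f : Fin n → D} → Injective _≡_ _≡_ f → (∀ i → f i ≢ d) →
                     Injective _≡_ _≡_ (extend d f)
  extend-injective {f = f} f-inj fresh {i} {j} = injective i j
    where
      injective : ∀ i j → extend _ f i ≡ extend _ f j → i ≡ j
      injective zero zero _ = refl
      injective zero (suc j) same = ⊥-elim (fresh j (sym same))
      injective (suc i) zero same = ⊥-elim (fresh i same)
      injective (suc i) (suc j) same = cong suc (f-inj same)

  AtLeast-insert : {P : D → Set} {n : ℕ} {d : D} → P d → AtLeast (λ y → P y × y ≢ d) n →
                   AtLeast P (suc n)
  AtLeast-insert Pd (distinct f f-inj Qf) =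
    distinct (extend _ f) (extend-injective f-inj (proj₂ ∘ Qf)) λ { zero → Pd ; (suc i) → proj₁ (Qf i) }

  module _ (lem : LEM) where
    open Classical lem

    AtLeast-remove : {P : D → Set} {n : ℕ} (d : D) → AtLeast P (suc n) → AtLeast (λ y → P y × y ≢ d) n
    AtLeast-remove d (distinct f f-inj Pf) with decide (Σ _ λ j → f j ≡ d)
    ... | yes (j , fj≡d) = distinct (f ∘ punchIn j) (punchIn-injective j _ _ ∘ f-inj)
                             λ i → Pf (punchIn j i) , λ same → punchInᵢ≢i j i (f-inj (trans same (sym fj≡d)))
    ... | no d∉f = distinct (f ∘ suc) (suc-injective ∘ f-inj)
                     λ i → Pf (suc i) , λ same → d∉f (suc i , same)

    AtLeast-exhausts : ∀ {P : D → Set} {m} → AtMost P m → (A : AtLeast P m) →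
                       ∀ {d} → P d → Σ (Fin m) λ t → AtLeast.elem A t ≡ d
    AtLeast-exhausts {P} {m} atMost A {d} Pd =
      ¬¬-elim λ d∉A → <-irrefl refl (atMost (AtLeast-insert Pd (A′ d∉A)))
      where
        open AtLeast A
        A′ : ¬ Σ (Fin m) (λ t → elem t ≡ d) → AtLeast (λ y → P y × y ≢ d) m
        A′ d∉A = distinct elem elem-injective λ t → elem-satisfies t , λ same → d∉A (t , same)

fresh-index : {A : Set} (xs : List (A × ℕ)) → Σ ℕ λ n → ∀ a → ¬ (a , n) ∈ xs
fresh-index {A} xs = bound xs , λ a a∈xs → <-irrefl refl (bound-above xs a∈xs)
  where
    bound : List (A × ℕ) → ℕ
    bound = L.foldr (λ (_ , i) m → suc i ⊔ m) 0
    bound-above : ∀ xs {y} → y ∈ xs → proj₂ y < bound xs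
    bound-above (_ ∷ ys) (here refl) = m≤n⇒m≤n⊔o (bound ys) ≤-refl
    bound-above ((_ , i) ∷ ys) (there y∈ys) = m≤n⇒m≤o⊔n (suc i) (bound-above ys y∈ys)

Sat-cong : ∀ {L k n} (φ : Fm L k n) {D : Set} {V : Val k D} {g g′ : Fin n → D} →
           (∀ i → g i ≡ g′ i) → Sat D V φ g → Sat D V φ g′
Sat-cong {L} {k} φ {D} {V} g≗g′ = go φ g≗g′
  where
    extend-cong : ∀ {n} (d : D) {g g′ : Fin n → D} → (∀ i → g i ≡ g′ i) → ∀ i → extend d g i ≡ extend d g′ i
    extend-cong d _ zero = refl
    extend-cong d g≗g′ (suc i) = g≗g′ i
    go : ∀ {n} (φ : Fm L k n) {g g′ : Fin n → D} → (∀ i → g i ≡ g′ i) → Sat D V φ g → Sat D V φ g′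
    go tt′ _ s = s
    go ff′ _ s = s
    go (atom a x) g≗g′ s = subst (V a) (g≗g′ x) s
    go (natom a x) g≗g′ s = s ∘ subst (V a) (sym (g≗g′ x))
    go (eq _ x y) g≗g′ s = trans (sym (g≗g′ x)) (trans s (g≗g′ y))
    go (neq _ x y) g≗g′ s = s ∘ λ same → trans (g≗g′ x) (trans same (sym (g≗g′ y)))
    go (or φ ψ) g≗g′ = Data.Sum.map (go φ g≗g′) (go ψ g≗g′)
    go (and φ ψ) g≗g′ (s , t) = go φ g≗g′ s , go ψ g≗g′ t
    go (ex φ) g≗g′ (d , s) = d , go φ (extend-cong d g≗g′) s
    go (all φ) g≗g′ s d = go φ (extend-cong d g≗g′) (s d)
    go (exInf _ φ) g≗g′ ¬finite = ¬finite ∘ Finite-⊆ (λ d → go φ (extend-cong d g≗g′))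
    go (allInf _ φ) g≗g′ = Finite-⊆ λ d ¬s′ s → ¬s′ (go φ (extend-cong d g≗g′) s)

-- Truncated cardinalities

data Card : Set where
  fin : ℕ → Card
  ∞ : Card

positive? : Card → Bool
positive? (fin zero) = false
positive? (fin (suc _)) = true
positive? ∞ = true

infinite? : Card → Bool
infinite? (fin _) = false
infinite? ∞ = true

Card-pred : Card → Card
Card-pred (fin m) = fin (pred m)
Card-pred ∞ = ∞

cards≤ : ℕ → List Card
cards≤ N = ∞ ∷ L.map (fin ∘ F.toℕ) (L.allFin (suc N))

fin∈cards≤ : ∀ {N j} → j ≤ N → fin j ∈ cards≤ N
fin∈cards≤ j≤N =
  there (subst (λ z → fin z ∈ _) (toℕ-fromℕ< (s≤s j≤N)) (∈-map⁺ (fin ∘ F.toℕ) (∈-allFin _)))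

cards≤-fin : ∀ {N m} → fin m ∈ cards≤ N → m ≤ N
cards≤-fin (there m∈) with ∈-map⁻ (fin ∘ F.toℕ) m∈
... | i , _ , refl = ≤-pred (toℕ<n i)

small? : ℕ → Card → Bool
small? N (fin m) = m <ᵇ N
small? N ∞ = false

fin-injective : ∀ {m n} → fin m ≡ fin n → m ≡ n
fin-injective refl = refl

finite : ∀ {x m} → x ≡ fin m → ¬ T (infinite? x)
finite refl ()

small⇒¬infinite : ∀ {N} x → T (small? N x) → ¬ T (infinite? x)
small⇒¬infinite (fin _) _ ()

full? : ℕ → Card → Bool
full? N (fin m) = m ≡ᵇ N
full? N ∞ = false

full?-correct : ∀ {N x} → T (full? N x) ⇔ x ≡ fin N
full?-correct {N} {fin m} = mk⇔ (cong fin ∘ ≡ᵇ⇒≡ m N) λ { refl → ≡⇒≡ᵇ N N refl }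
full?-correct {x = ∞} = mk⇔ (λ ()) λ ()

module _ {D : Set} where

  -- Counts are truncated at the threshold N: fin m with m ≥ N only says "finite, at least N".
  HasCard : ℕ → (D → Set) → Card → Set
  HasCard N P ∞ = ¬ Finite P
  HasCard N P (fin m) = Finite P × AtLeast P (m ⊓ N) × (m < N → AtMost P m)

  HasCard-resp : ∀ {N} {P Q : D → Set} x → (∀ d → P d → Q d) → (∀ d → Q d → P d) →
                 HasCard N P x → HasCard N Q x
  HasCard-resp ∞ P⊆Q _ ¬finP finQ = ¬finP (Finite-⊆ P⊆Q finQ)
  HasCard-resp (fin n) P⊆Q Q⊆P (finP , distinct f f-inj Pf , atMost) =
    Finite-⊆ Q⊆P finP , distinct f f-inj (λ i → P⊆Q _ (Pf i)) ,
    λ n<N (distinct g g-inj Qg) → atMost n<N (distinct g g-inj λ i → Q⊆P _ (Qg i))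

  HasCard-lower : ∀ {N} {P : D → Set} x → HasCard (suc N) P x → HasCard N P x
  HasCard-lower ∞ ¬finP = ¬finP
  HasCard-lower {N} (fin n) (finP , atLeast , atMost) =
    finP , AtLeast-≤ (⊓-monoʳ-≤ n (n≤1+n N)) atLeast , λ n<N → atMost (≤-trans n<N (n≤1+n N))

  HasCard-positive : ∀ {N} {P : D → Set} x {d} → HasCard (suc N) P x → P d → T (positive? x)
  HasCard-positive ∞ _ _ = tt
  HasCard-positive (fin (suc n)) _ _ = tt
  HasCard-positive (fin zero) (_ , _ , atMost) Pd
    with () ← atMost (s≤s z≤n) (AtLeast-insert Pd AtLeast-zero)

  HasCard-infinite : ∀ {N} {P : D → Set} x → T (infinite? x) → HasCard N P x → ¬ Finite P
  HasCard-infinite ∞ _ ¬finP = ¬finP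

  module _ (lem : LEM) where
    open Classical lem

    HasCard-witness : ∀ {N} {P : D → Set} x → HasCard (suc N) P x → T (positive? x) → Σ D P
    HasCard-witness ∞ ¬finP _ = ¬¬-elim λ ¬P → ¬finP ([] , λ d Pd → ⊥-elim (¬P (d , Pd)))
    HasCard-witness (fin (suc n)) (_ , distinct f _ Pf , _) _ = f zero , Pf zero

    HasCard-remove : ∀ {N} {P : D → Set} x {d} → HasCard (suc N) P x → P d →
                     HasCard N (λ y → P y × y ≢ d) (Card-pred x)
    HasCard-remove {P = P} ∞ {d} ¬finP Pd (xs , cover) = ¬finP (d ∷ xs , covers)
      where
        covers : ∀ y → P y → y ∈ d ∷ xs
        covers y Py with y ≟ d
        ... | yes refl = here refl
        ... | no y≢d = there (cover y (Py , y≢d))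
    HasCard-remove (fin zero) (_ , _ , atMost) Pd
      with () ← atMost (s≤s z≤n) (AtLeast-insert Pd AtLeast-zero)
    HasCard-remove (fin (suc n)) {d} (finP , atLeast , atMost) Pd =
      Finite-⊆ (λ _ → proj₁) finP , AtLeast-remove lem d atLeast ,
      λ n<N atLeast′ → ≤-pred (atMost (s≤s n<N) (AtLeast-insert Pd atLeast′))

    AtLeast-largest : ∀ {P : D → Set} t → ¬ AtLeast P (suc t) →
                      Σ ℕ λ j → j ≤ t × AtLeast P j × AtMost P j
    AtLeast-largest zero ¬one = 0 , z≤n , AtLeast-zero , ¬AtLeast⇒AtMost ¬one
    AtLeast-largest {P} (suc t) ¬more with decide (AtLeast P (suc t))
    ... | yes atLeast = suc t , ≤-refl , atLeast , ¬AtLeast⇒AtMost ¬more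
    ... | no ¬atLeast with AtLeast-largest t ¬atLeast
    ...   | j , j≤t , atLeast , atMost = j , ≤-trans j≤t (n≤1+n t) , atLeast , atMost

    HasCard-exists : ∀ N (P : D → Set) → Σ Card λ x → x ∈ cards≤ N × HasCard N P x
    HasCard-exists N P with decide (Finite P) | decide (AtLeast P N)
    ... | no ¬finP | _ = ∞ , here refl , ¬finP
    ... | yes finP | yes atLeast =
      fin N , fin∈cards≤ ≤-refl , finP , subst (AtLeast P) (sym (⊓-idem N)) atLeast ,
      λ N<N → ⊥-elim (<-irrefl refl N<N)
    HasCard-exists zero P | yes _ | no ¬atLeast = ⊥-elim (¬atLeast AtLeast-zero)
    HasCard-exists (suc t) P | yes finP | no ¬atLeast with AtLeast-largest t ¬atLeast
    ... | j , j≤t , atLeast , atMost = fin j , fin∈cards≤ (≤-trans j≤t (n≤1+n t)) , finP ,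
          subst (AtLeast P) (sym (m≤n⇒m⊓n≡m (≤-trans j≤t (n≤1+n t)))) atLeast , λ _ → atMost

-- Colours

Colour : ℕ → Set
Colour = Vec Bool

_≟ᶜ_ : ∀ {k} → DecidableEquality (Colour k)
_≟ᶜ_ = VP.≡-dec Data.Bool._≟_

allColours : ∀ k → List (Colour k)
allColours zero = [] ∷ []
allColours (suc k) = L.map (true ∷_) (allColours k) L.++ L.map (false ∷_) (allColours k)

∈-allColours : ∀ {k} (c : Colour k) → c ∈ allColours k
∈-allColours [] = here refl
∈-allColours (true ∷ c) = ∈-++⁺ˡ (∈-map⁺ (true ∷_) (∈-allColours c))
∈-allColours (false ∷ c) = ∈-++⁺ʳ (L.map (true ∷_) (allColours _)) (∈-map⁺ (false ∷_) (∈-allColours c))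

Colour-ext : ∀ {k} {c c′ : Colour k} → (∀ a → lookup c a ≡ lookup c′ a) → c ≡ c′
Colour-ext {c = c} {c′} same = begin
  c                      ≡⟨ VP.tabulate∘lookup c ⟨
  V.tabulate (lookup c)  ≡⟨ VP.tabulate-cong same ⟩
  V.tabulate (lookup c′) ≡⟨ VP.tabulate∘lookup c′ ⟩
  c′                     ∎
  where open ≡-Reasoning

record HasColour {k} {D : Set} (V : Val k D) (d : D) (c : Colour k) : Set where
  constructor hasColour
  field colour-at : ∀ a → V a d ⇔ T (lookup c a)
open HasColour

HasColour-unique : ∀ {k} {D : Set} {V : Val k D} {d c c′} → HasColour V d c → HasColour V d c′ → c ≡ c′
HasColour-unique (hasColour d∶c) (hasColour d∶c′) = Colour-ext λ a →
  T⇔⇒≡ (to (d∶c′ a) ∘ from (d∶c a)) (to (d∶c a) ∘ from (d∶c′ a))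

module _ (lem : LEM) where
  open Classical lem

  colourOf : ∀ {k} {D : Set} → Val k D → D → Colour k
  colourOf V d = V.tabulate λ a → does (decide (V a d))

  colourOf-correct : ∀ {k} {D : Set} (V : Val k D) d → HasColour V d (colourOf V d)
  colourOf-correct V d = hasColour at
    where
      at : ∀ a → V a d ⇔ T (lookup (colourOf V d) a)
      at a rewrite VP.lookup∘tabulate (λ a → does (decide (V a d))) a with decide (V a d)
      ... | yes Vad = mk⇔ _ λ _ → Vad
      ... | no ¬Vad = mk⇔ ¬Vad λ ()

-- Profiles

-- The data of (V, g) that formulas of bounded depth can see: the distinct values of the variables
-- with their colours, and for each colour the number of the remaining elements carrying it.
record Profile (k n : ℕ) : Set where
  constructor profile
  field
    named : ℕ
    label : Fin named → Colour k
    var : Fin n → Fin named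
    unnamed : Colour k → Card
open Profile

takeFrom : ∀ {k} → Colour k → (Colour k → Card) → Colour k → Card
takeFrom c r c′ = if does (c′ ≟ᶜ c) then Card-pred (r c) else r c′

bindNamed : ∀ {k n} (s : Profile k n) → Fin (named s) → Profile k (suc n)
bindNamed (profile m lab v r) j = profile m lab (extend j v) r

bindFresh : ∀ {k n} → Profile k n → Colour k → Profile k (suc n)
bindFresh (profile m lab v r) c = profile (suc m) (extend c lab) (extend zero (suc ∘ v)) (takeFrom c r)

initial : ∀ {k} → (Colour k → Card) → Profile k 0
initial r = profile 0 (λ ()) (λ ()) r

eval : ∀ {L k n} → Fm L k n → Profile k n → Bool
eval tt′ s = true
eval ff′ s = false
eval (atom a x) s = lookup (label s (var s x)) a
eval (natom a x) s = not (lookup (label s (var s x)) a)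
eval (eq _ x y) s = isYes (var s x F.≟ var s y)
eval (neq _ x y) s = not (isYes (var s x F.≟ var s y))
eval (or φ ψ) s = eval φ s ∨ eval ψ s
eval (and φ ψ) s = eval φ s ∧ eval ψ s
eval {k = k} (ex φ) s =
  anyᵇ (λ j → eval φ (bindNamed s j)) (L.allFin (named s)) ∨
  anyᵇ (λ c → positive? (unnamed s c) ∧ eval φ (bindFresh s c)) (allColours k)
eval {k = k} (all φ) s =
  allᵇ (λ j → eval φ (bindNamed s j)) (L.allFin (named s)) ∧
  allᵇ (λ c → not (positive? (unnamed s c)) ∨ eval φ (bindFresh s c)) (allColours k)
eval {k = k} (exInf _ φ) s =
  anyᵇ (λ c → infinite? (unnamed s c) ∧ eval φ (bindFresh s c)) (allColours k)
eval {k = k} (allInf _ φ) s =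
  allᵇ (λ c → not (infinite? (unnamed s c)) ∨ eval φ (bindFresh s c)) (allColours k)

depth : ∀ {L k n} → Fm L k n → ℕ
depth (or φ ψ) = depth φ ⊔ depth ψ
depth (and φ ψ) = depth φ ⊔ depth ψ
depth (ex φ) = suc (depth φ)
depth (all φ) = suc (depth φ)
depth (exInf _ φ) = suc (depth φ)
depth (allInf _ φ) = suc (depth φ)
depth _ = 0

Unnamed : ∀ {k m} {D : Set} → Val k D → (Fin m → D) → Colour k → D → Set
Unnamed V e c d = HasColour V d c × (∀ j → e j ≢ d)

record Realises {k n} (N : ℕ) (s : Profile k n) {D : Set} (V : Val k D) (g : Fin n → D) : Set where
  field
    elem : Fin (named s) → D
    elem-injective : Injective _≡_ _≡_ elem
    var-elem : ∀ i → g i ≡ elem (var s i)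
    elem-colour : ∀ j → HasColour V (elem j) (label s j)
    unnamed-card : ∀ c → HasCard N (Unnamed V elem c) (unnamed s c)

module _ {k n N : ℕ} {s : Profile k n} {D : Set} {V : Val k D} {g : Fin n → D} where

  realises-bindNamed : (R : Realises (suc N) s V g) (j : Fin (named s)) →
                       Realises N (bindNamed s j) V (extend (Realises.elem R j) g)
  realises-bindNamed R j = record
    { elem = elem ; elem-injective = elem-injective ; elem-colour = elem-colour
    ; var-elem = λ { zero → refl ; (suc i) → var-elem i }
    ; unnamed-card = λ c → HasCard-lower (unnamed s c) (unnamed-card c) }
    where open Realises R

  realises-bindFresh : LEM → (R : Realises (suc N) s V g) {c : Colour k} {d : D} →
                       Unnamed V (Realises.elem R) c d → Realises N (bindFresh s c) V (extend d g)
  realises-bindFresh lem R {c} {d} (d∶c , d-unnamed) = record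
    { elem = extend d elem ; elem-injective = extend-injective elem-injective d-unnamed
    ; var-elem = λ { zero → refl ; (suc i) → var-elem i }
    ; elem-colour = λ { zero → d∶c ; (suc j) → elem-colour j }
    ; unnamed-card = card }
    where
      open Realises R
      shrink : ∀ c′ {y} → Unnamed V (extend d elem) c′ y → Unnamed V elem c′ y × y ≢ d
      shrink c′ (y∶c′ , y-unnamed) = (y∶c′ , y-unnamed ∘ suc) , y-unnamed zero ∘ sym
      grow : ∀ c′ {y} → Unnamed V elem c′ y → y ≢ d → Unnamed V (extend d elem) c′ y
      grow c′ (y∶c′ , y-unnamed) y≢d = y∶c′ , λ { zero → y≢d ∘ sym ; (suc j) → y-unnamed j }
      grow-other : ∀ c′ {y} → c′ ≢ c → Unnamed V elem c′ y → Unnamed V (extend d elem) c′ y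
      grow-other c′ c′≢c y@(y∶c′ , _) = grow c′ y λ { refl → c′≢c (HasColour-unique {V = V} y∶c′ d∶c) }
      card : ∀ c′ → HasCard N (Unnamed V (extend d elem) c′) (takeFrom c (unnamed s) c′)
      card c′ with c′ ≟ᶜ c
      ... | yes refl = HasCard-resp (Card-pred (unnamed s c)) (λ _ (y , y≢d) → grow c y y≢d) (λ _ → shrink c)
                         (HasCard-remove lem (unnamed s c) (unnamed-card c) (d∶c , d-unnamed))
      ... | no c′≢c = HasCard-resp (unnamed s c′) (λ _ → grow-other c′ c′≢c) (λ _ → proj₁ ∘ shrink c′)
                         (HasCard-lower (unnamed s c′) (unnamed-card c′))

module Semantics (lem : LEM) {k : ℕ} {D : Set} (V : Val k D) where
  open Classical lem

  module _ {n N : ℕ} {s : Profile k n} {g : Fin n → D} (R : Realises N s V g) where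
    open Realises R

    classify : ∀ d → (Σ (Fin (named s)) λ j → elem j ≡ d) ⊎ Unnamed V elem (colourOf lem V d) d
    classify d with decide (Σ _ λ j → elem j ≡ d)
    ... | yes d-named = inj₁ d-named
    ... | no ¬named = inj₂ (colourOf-correct lem V d , λ j same → ¬named (j , same))

    Finite-of-finite-classes : {P : D → Set} →
      (∀ d → P d → Unnamed V elem (colourOf lem V d) d → ¬ T (infinite? (unnamed s (colourOf lem V d)))) →
      Finite P
    Finite-of-finite-classes {P} finite-class =
      Finite-⊆ sort (Finite-∪ (Finite-range elem) (Finite-⋃ (allColours k) finite-unnamed))
      where
        finite-unnamed : ∀ c → Finite (λ d → Unnamed V elem c d × ¬ T (infinite? (unnamed s c)))
        finite-unnamed c with unnamed s c | unnamed-card c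
        ... | ∞ | _ = [] , λ _ (_ , finite) → ⊥-elim (finite tt)
        ... | fin _ | (finite , _) = Finite-⊆ (λ _ → proj₁) finite
        sort : ∀ d → P d → (Σ (Fin (named s)) λ j → elem j ≡ d) ⊎
               Σ (Colour k) λ c → c ∈ allColours k × (Unnamed V elem c d × ¬ T (infinite? (unnamed s c)))
        sort d Pd with classify d
        ... | inj₁ d-named = inj₁ d-named
        ... | inj₂ u = inj₂ (_ , ∈-allColours _ , u , finite-class d Pd u)

    var-colour : ∀ x a → V a (g x) ⇔ T (lookup (label s (var s x)) a)
    var-colour x a = subst (λ y → V a y ⇔ _) (sym (var-elem x)) (colour-at (elem-colour (var s x)) a)

    var-≡ : ∀ x y → g x ≡ g y ⇔ T (isYes (var s x F.≟ var s y))
    var-≡ x y = mk⇔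
      (λ same → fromWitness {a? = var s x F.≟ var s y}
                  (elem-injective (trans (sym (var-elem x)) (trans same (var-elem y)))))
      (λ same → trans (var-elem x)
                  (trans (cong elem (toWitness {a? = var s x F.≟ var s y} same)) (sym (var-elem y))))

  Correct : ∀ {L n} → ℕ → Fm L k n → Set
  Correct N φ = ∀ {s g} → Realises N s V g → Sat D V φ g ⇔ T (eval φ s)

  module Quantifier {L : Lang} {n N : ℕ} {φ : Fm L k (suc n)} (IH : Correct N φ)
                    {s : Profile k n} {g : Fin n → D} (R : Realises (suc N) s V g) where
    open Realises R

    named? : Fin (named s) → Bool
    named? j = eval φ (bindNamed s j)

    fresh? : Colour k → Bool
    fresh? c = eval φ (bindFresh s c)

    named-case : ∀ j → Sat D V φ (extend (elem j) g) ⇔ T (eval φ (bindNamed s j))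
    named-case j = IH (realises-bindNamed R j)

    fresh-case : ∀ {c d} → Unnamed V elem c d → Sat D V φ (extend d g) ⇔ T (eval φ (bindFresh s c))
    fresh-case u = IH (realises-bindFresh lem R u)

    eval-ex : Sat D V (ex φ) g ⇔ T (eval (ex φ) s)
    eval-ex = mk⇔ to′ from′
      where
        anyNamed : T (anyᵇ named? (L.allFin (named s))) ⇔ Σ (Fin (named s)) (T ∘ named?)
        anyNamed = T-any-complete ∈-allFin named?
        anyFresh : T (anyᵇ (λ c → positive? (unnamed s c) ∧ fresh? c) (allColours k)) ⇔
                   Σ (Colour k) λ c → T (positive? (unnamed s c) ∧ fresh? c)
        anyFresh = T-any-complete ∈-allColours λ c → positive? (unnamed s c) ∧ fresh? c
        to′ : Sat D V (ex φ) g → T (eval (ex φ) s)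
        to′ (d , φd) with classify R d
        ... | inj₁ (j , refl) = from T-∨ (inj₁ (from anyNamed (j , to (named-case j) φd)))
        ... | inj₂ u = from T-∨ (inj₂ (from anyFresh
                         (_ , from T-∧ (HasCard-positive _ (unnamed-card _) u , to (fresh-case u) φd))))
        from′ : T (eval (ex φ) s) → Sat D V (ex φ) g
        from′ t with to T-∨ t
        ... | inj₁ t₁ = let j , φj = to anyNamed t₁ in elem j , from (named-case j) φj
        ... | inj₂ t₂ = let c , t₃ = to anyFresh t₂ ; pos , φc = to T-∧ t₃
                            d , u = HasCard-witness lem _ (unnamed-card c) pos
                        in d , from (fresh-case u) φc

    eval-all : Sat D V (all φ) g ⇔ T (eval (all φ) s)
    eval-all = mk⇔ to′ from′
      where
        allNamed : T (allᵇ named? (L.allFin (named s))) ⇔ (∀ j → T (named? j))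
        allNamed = T-all-complete ∈-allFin named?
        allFresh : T (allᵇ (λ c → not (positive? (unnamed s c)) ∨ fresh? c) (allColours k)) ⇔
                   (∀ c → T (not (positive? (unnamed s c)) ∨ fresh? c))
        allFresh = T-all-complete ∈-allColours λ c → not (positive? (unnamed s c)) ∨ fresh? c
        to′ : Sat D V (all φ) g → T (eval (all φ) s)
        to′ φall = from T-∧ (from allNamed (λ j → to (named-case j) (φall (elem j))) ,
                             from allFresh λ c → from T-⇒ λ pos →
                               let d , u = HasCard-witness lem _ (unnamed-card c) pos
                               in to (fresh-case u) (φall d))
        from′ : T (eval (all φ) s) → Sat D V (all φ) g
        from′ t d with to T-∧ t | classify R d
        ... | tNamed , _ | inj₁ (j , refl) = from (named-case j) (to allNamed tNamed j)
        ... | _ , tFresh | inj₂ u =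
          from (fresh-case u) (to T-⇒ (to allFresh tFresh _) (HasCard-positive _ (unnamed-card _) u))

    eval-exInf : ∀ p → Sat D V (exInf p φ) g ⇔ T (eval (exInf p φ) s)
    eval-exInf p = mk⇔ to′ from′
      where
        anyInf : T (anyᵇ (λ c → infinite? (unnamed s c) ∧ fresh? c) (allColours k)) ⇔
                 Σ (Colour k) λ c → T (infinite? (unnamed s c) ∧ fresh? c)
        anyInf = T-any-complete ∈-allColours λ c → infinite? (unnamed s c) ∧ fresh? c
        to′ : Sat D V (exInf p φ) g → T (eval (exInf p φ) s)
        to′ ¬finite = decidable-stable (T? _) λ ¬t → ¬finite (Finite-of-finite-classes R λ d φd u inf →
                        ¬t (from anyInf (_ , from T-∧ (inf , to (fresh-case u) φd))))
        from′ : T (eval (exInf p φ) s) → Sat D V (exInf p φ) g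
        from′ t finite = let c , t′ = to anyInf t ; inf , φc = to T-∧ t′ in
          HasCard-infinite _ inf (unnamed-card c) (Finite-⊆ (λ d u → from (fresh-case u) φc) finite)

    eval-allInf : ∀ p → Sat D V (allInf p φ) g ⇔ T (eval (allInf p φ) s)
    eval-allInf p = mk⇔ to′ from′
      where
        allInf′ : T (allᵇ (λ c → not (infinite? (unnamed s c)) ∨ fresh? c) (allColours k)) ⇔
                  (∀ c → T (not (infinite? (unnamed s c)) ∨ fresh? c))
        allInf′ = T-all-complete ∈-allColours λ c → not (infinite? (unnamed s c)) ∨ fresh? c
        to′ : Sat D V (allInf p φ) g → T (eval (allInf p φ) s)
        to′ finite = from allInf′ λ c → from T-⇒ λ inf → decidable-stable (T? _) λ ¬t →
          HasCard-infinite _ inf (unnamed-card c) (Finite-⊆ (λ d u φd → ¬t (to (fresh-case u) φd)) finite)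
        from′ : T (eval (allInf p φ) s) → Sat D V (allInf p φ) g
        from′ t = Finite-of-finite-classes R λ d ¬φd u inf →
          ¬φd (from (fresh-case u) (to T-⇒ (to allInf′ t _) inf))

  eval-correct : ∀ {L n} (φ : Fm L k n) {N} → depth φ ≤ N → Correct N φ
  eval-correct tt′ _ _ = mk⇔ _ _
  eval-correct ff′ _ _ = mk⇔ (λ ()) (λ ())
  eval-correct (atom a x) _ R = var-colour R x a
  eval-correct (natom a x) _ R = ⇔.trans (¬-cong (var-colour R x a)) (⇔.sym T-not)
  eval-correct (eq _ x y) _ R = var-≡ R x y
  eval-correct (neq _ x y) _ R = ⇔.trans (¬-cong (var-≡ R x y)) (⇔.sym T-not)
  eval-correct (or φ ψ) d R = ⇔.trans
    (eval-correct φ (m⊔n≤o⇒m≤o (depth φ) _ d) R ⊎-⇔ eval-correct ψ (m⊔n≤o⇒n≤o (depth φ) _ d) R)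
    (⇔.sym T-∨)
  eval-correct (and φ ψ) d R = ⇔.trans
    (eval-correct φ (m⊔n≤o⇒m≤o (depth φ) _ d) R ×-⇔ eval-correct ψ (m⊔n≤o⇒n≤o (depth φ) _ d) R)
    (⇔.sym T-∧)
  eval-correct (ex φ) (s≤s d) R = Quantifier.eval-ex {φ = φ} (eval-correct φ d) R
  eval-correct (all φ) (s≤s d) R = Quantifier.eval-all {φ = φ} (eval-correct φ d) R
  eval-correct (exInf p φ) (s≤s d) R = Quantifier.eval-exInf {φ = φ} (eval-correct φ d) R p
  eval-correct (allInf p φ) (s≤s d) R = Quantifier.eval-allInf {φ = φ} (eval-correct φ d) R p

ColourCounts : ∀ {k} → ℕ → {D : Set} → Val k D → (Colour k → Card) → Set
ColourCounts N V r = ∀ c → HasCard N (λ d → HasColour V d c) (r c)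

module _ {k N : ℕ} {D : Set} {V : Val k D} {r : Colour k → Card} where

  realises-initial : ColourCounts N V r → Realises N (initial r) V noVars
  realises-initial counts = record
    { elem = λ () ; elem-injective = λ { {()} } ; var-elem = λ () ; elem-colour = λ ()
    ; unnamed-card = λ c → HasCard-resp (r c) (λ _ d∶c → d∶c , λ ()) (λ _ → proj₁) (counts c) }

  ColourCounts-cong : ∀ {r′} → (∀ c → r c ≡ r′ c) → ColourCounts N V r → ColourCounts N V r′
  ColourCounts-cong same counts c = subst (HasCard N _) (same c) (counts c)

module _ (lem : LEM) where

  eval-sentence : ∀ {L k N} {D : Set} {V : Val k D} {r} (φ : Sentence L k) →
                  depth φ ≤ N → ColourCounts N V r → Sat D V φ noVars ⇔ T (eval φ (initial r))
  eval-sentence {V = V} φ φ≤N counts = Semantics.eval-correct lem V φ φ≤N (realises-initial counts)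

  ColourCounts-exists : ∀ {k} N {D : Set} (V : Val k D) →
                        Σ (Colour k → Card) λ r → (∀ c → r c ∈ cards≤ N) × ColourCounts N V r
  ColourCounts-exists {k} N V =
    (λ c → proj₁ (card c)) , (λ c → proj₁ (proj₂ (card c))) , (λ c → proj₂ (proj₂ (card c)))
    where
      card : ∀ c → Σ Card λ x → x ∈ cards≤ N × HasCard N (λ d → HasColour V d c) x
      card c = HasCard-exists lem N (λ d → HasColour V d c)

module _ {X : Set} where

  functions : ∀ k → List X → List (Colour k → X)
  functions zero xs = L.map (λ x _ → x) xs
  functions (suc k) xs = L.concatMap (λ f → L.map (cases f) (functions k xs)) (functions k xs)
    where
      cases : (Colour k → X) → (Colour k → X) → Colour (suc k) → X
      cases f g (true ∷ c) = f c
      cases f g (false ∷ c) = g c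

  functions-complete : ∀ k {xs : List X} (h : Colour k → X) → (∀ c → h c ∈ xs) →
                       Σ (Colour k → X) λ f → f ∈ functions k xs × (∀ c → f c ≡ h c)
  functions-complete zero h h∈xs = (λ _ → h []) , ∈-map⁺ (λ x _ → x) (h∈xs []) , λ { [] → refl }
  functions-complete (suc k) h h∈xs
    with functions-complete k (h ∘ (true ∷_)) (h∈xs ∘ (true ∷_))
       | functions-complete k (h ∘ (false ∷_)) (h∈xs ∘ (false ∷_))
  ... | f , f∈ , f≗ | g , g∈ , g≗ =
    _ , ∈-concat⁺′ (∈-map⁺ _ g∈) (∈-map⁺ _ f∈) , λ { (true ∷ c) → f≗ c ; (false ∷ c) → g≗ c }

  functions-sound : ∀ k {xs : List X} {f} → f ∈ functions k xs → ∀ c → f c ∈ xs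
  functions-sound zero f∈ c with ∈-map⁻ (λ x _ → x) f∈
  ... | _ , x∈xs , refl = x∈xs
  functions-sound (suc k) f∈ c with find (∈-concatMap⁻ _ {xs = functions k _} f∈)
  ... | _ , f₁∈ , f∈′ with ∈-map⁻ _ f∈′
  ... | _ , f₂∈ , refl with c
  ...   | true ∷ c′ = functions-sound k f₁∈ c′
  ...   | false ∷ c′ = functions-sound k f₂∈ c′

module Canonical {k : ℕ} (r : Colour k → Card) where

  Below : Card → ℕ → Set
  Below ∞ i = ⊤
  Below (fin m) i = i < m

  Below-irrelevant : ∀ x i (p q : Below x i) → p ≡ q
  Below-irrelevant ∞ i _ _ = refl
  Below-irrelevant (fin m) i p q = <-irrelevant p q

  Dom : Set
  Dom = Σ (Colour k × ℕ) λ (c , i) → Below (r c) i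

  colour : Dom → Colour k
  colour ((c , _) , _) = c

  Val′ : Val k Dom
  Val′ a d = T (lookup (colour d) a)

  HasColour-canonical : ∀ d {c} → HasColour Val′ d c ⇔ colour d ≡ c
  HasColour-canonical d = mk⇔ (HasColour-unique (hasColour λ _ → mk⇔ id id))
                              (λ { refl → hasColour λ _ → mk⇔ id id })

  Dom-≡ : ∀ {c i j} {p : Below (r c) i} {q : Below (r c) j} → i ≡ j →
          _≡_ {A = Dom} ((c , i) , p) ((c , j) , q)
  Dom-≡ {c} {i} {p = p} {q} refl = cong ((c , i) ,_) (Below-irrelevant (r c) i p q)

  Class : Colour k → Dom → Set
  Class c d = colour d ≡ c

  class-elements : ∀ c n → (∀ i → i < n → Below (r c) i) → AtLeast (Class c) n
  class-elements c n below = distinct (λ i → (c , F.toℕ i) , below _ (toℕ<n i))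
                                      (toℕ-injective ∘ cong (proj₂ ∘ proj₁)) (λ _ → refl)

  class-card : ∀ N c x → r c ≡ x → HasCard N (Class c) x
  class-card N c ∞ r≡∞ =
    ¬Finite-if-unbounded λ n → class-elements c n λ i _ → subst (λ x → Below x i) (sym r≡∞) tt
  class-card N c (fin m) r≡m =
    Finite-⊆ cover (Finite-range element) , AtLeast-≤ (m⊓n≤m m N) elements , λ _ → AtMost-range element cover
    where
      elements : AtLeast (Class c) m
      elements = class-elements c m λ i i<m → subst (λ x → Below x i) (sym r≡m) i<m
      element : Fin m → Dom
      element = AtLeast.elem elements
      cover : ∀ d → Class c d → Σ (Fin m) λ t → element t ≡ d
      cover ((_ , i) , below) refl = let i<m = subst (λ x → Below x i) r≡m below in
        F.fromℕ< i<m , Dom-≡ (toℕ-fromℕ< i<m)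

  canonical-counts : ∀ N → ColourCounts N Val′ r
  canonical-counts N c =
    HasCard-resp (r c) (λ d → from (HasColour-canonical d)) (λ d → to (HasColour-canonical d))
                 (class-card N c (r c) refl)

-- Deciding equivalence

agree? : ∀ {L k} → Sentence L k → Sentence L k → (Colour k → Card) → Bool
agree? φ ψ r = isYes (eval φ (initial r) Data.Bool.≟ eval ψ (initial r))

equivalent? : ∀ {L k} → Sentence L k → Sentence L k → Bool
equivalent? {k = k} φ ψ = allᵇ (agree? φ ψ) (functions k (cards≤ (depth φ ⊔ depth ψ)))

module _ (lem : LEM) {L : Lang} {k : ℕ} (φ ψ : Sentence L k) where

  private
    N : ℕ
    N = depth φ ⊔ depth ψ
    φ≤N : depth φ ≤ N
    φ≤N = m≤m⊔n (depth φ) (depth ψ)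
    ψ≤N : depth ψ ≤ N
    ψ≤N = m≤n⊔m (depth φ) (depth ψ)

  equivalent?-sound : T (equivalent? φ ψ) → Equivalent φ ψ
  equivalent?-sound t D V with ColourCounts-exists lem N V
  ... | r , r∈ , counts with functions-complete k r r∈
  ... | f , f∈ , f≗r = ⇔.trans (subst (λ b → _ ⇔ T b) same (eval-sentence lem φ φ≤N counts′))
                               (⇔.sym (eval-sentence lem ψ ψ≤N counts′))
    where
      counts′ : ColourCounts N V f
      counts′ = ColourCounts-cong (sym ∘ f≗r) counts
      same : eval φ (initial f) ≡ eval ψ (initial f)
      same = toWitness {a? = eval φ (initial f) Data.Bool.≟ _} (All.lookup (all⁺ (agree? φ ψ) _ t) f∈)

  equivalent?-complete : Equivalent φ ψ → T (equivalent? φ ψ)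
  equivalent?-complete φ≡ψ = all⁻ (agree? φ ψ) {functions k (cards≤ N)} (All.tabulate λ {r} _ →
    fromWitness {a? = eval φ (initial r) Data.Bool.≟ _} (T⇔⇒≡
      (to (eval-sentence lem ψ ψ≤N (counts r)) ∘ to (φ≡ψ _ _) ∘ from (eval-sentence lem φ φ≤N (counts r)))
      (to (eval-sentence lem φ φ≤N (counts r)) ∘ from (φ≡ψ _ _) ∘ from (eval-sentence lem ψ ψ≤N (counts r)))))
    where
      counts : ∀ r → ColourCounts N (Canonical.Val′ r) r
      counts r = Canonical.canonical-counts r N

-- Syntactically continuous formulas are continuous

module SyntacticContinuity {k : ℕ} (B : Subset k) where

  AgreeOff : {D : Set} → Val k D → Val k D → Set
  AgreeOff {D} V V′ = ∀ a → a ∉ B → ∀ d → V a d ⇔ V′ a d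

  AgreeOff-sym : {D : Set} {V V′ : Val k D} → AgreeOff V V′ → AgreeOff V′ V
  AgreeOff-sym agree a a∉B d = ⇔.sym (agree a a∉B d)

  ≤⇒AgreeOff : {D : Set} {V V′ : Val k D} → V ≤[ B ] V′ → AgreeOff V V′
  ≤⇒AgreeOff V≤V′ a = proj₂ (V≤V′ a)

  ≤-trans′ : {D : Set} {U₁ U₂ U₃ : Val k D} → U₁ ≤[ B ] U₂ → U₂ ≤[ B ] U₃ → U₁ ≤[ B ] U₃
  ≤-trans′ U₁≤U₂ U₂≤U₃ a = (λ a∈B d → proj₁ (U₂≤U₃ a) a∈B d ∘ proj₁ (U₁≤U₂ a) a∈B d) ,
                           (λ a∉B d → ⇔.trans (proj₂ (U₁≤U₂ a) a∉B d) (proj₂ (U₂≤U₃ a) a∉B d))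

  NoB-invariant : ∀ {L n} {ψ : Fm L k n} → NoB B ψ → {D : Set} {V V′ : Val k D} → AgreeOff V V′ →
                  ∀ g → Sat D V ψ g → Sat D V′ ψ g
  NoB-invariant tt′ _ _ s = s
  NoB-invariant ff′ _ _ s = s
  NoB-invariant (atom {a = a} {x} a∉B) agree g s = to (agree a a∉B (g x)) s
  NoB-invariant (natom {a = a} {x} a∉B) agree g s = s ∘ from (agree a a∉B (g x))
  NoB-invariant (eq _ _ _) _ _ s = s
  NoB-invariant (neq _ _ _) _ _ s = s
  NoB-invariant (or ψ₁ _) agree g (inj₁ s) = inj₁ (NoB-invariant ψ₁ agree g s)
  NoB-invariant (or _ ψ₂) agree g (inj₂ s) = inj₂ (NoB-invariant ψ₂ agree g s)
  NoB-invariant (and ψ₁ ψ₂) agree g (s₁ , s₂) = NoB-invariant ψ₁ agree g s₁ , NoB-invariant ψ₂ agree g s₂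
  NoB-invariant (ex ψ) agree g (d , s) = d , NoB-invariant ψ agree (extend d g) s
  NoB-invariant (all ψ) agree g s d = NoB-invariant ψ agree (extend d g) (s d)
  NoB-invariant (exInf _ ψ) agree g ¬finite =
    ¬finite ∘ Finite-⊆ (λ d → NoB-invariant ψ agree (extend d g))
  NoB-invariant (allInf _ ψ) agree g finite =
    Finite-⊆ (λ d ¬s′ s → ¬s′ (NoB-invariant ψ agree (extend d g) s)) finite

  SynCont⇒Monotone : ∀ {L n} {φ : Fm L k n} → SynCont B φ → Monotone B φ
  SynCont⇒Monotone (base ψ) D V V′ g s V≤V′ = NoB-invariant ψ (≤⇒AgreeOff V≤V′) g s
  SynCont⇒Monotone (atom {x = x} b∈B) D V V′ g s V≤V′ = proj₁ (V≤V′ _) b∈B (g x) s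
  SynCont⇒Monotone (and φ₁ φ₂) D V V′ g (s₁ , s₂) V≤V′ =
    SynCont⇒Monotone φ₁ D V V′ g s₁ V≤V′ , SynCont⇒Monotone φ₂ D V V′ g s₂ V≤V′
  SynCont⇒Monotone (or φ₁ _) D V V′ g (inj₁ s) V≤V′ = inj₁ (SynCont⇒Monotone φ₁ D V V′ g s V≤V′)
  SynCont⇒Monotone (or _ φ₂) D V V′ g (inj₂ s) V≤V′ = inj₂ (SynCont⇒Monotone φ₂ D V V′ g s V≤V′)
  SynCont⇒Monotone (ex φ) D V V′ g (d , s) V≤V′ = d , SynCont⇒Monotone φ D V V′ (extend d g) s V≤V′
  SynCont⇒Monotone (w p φ ψ) D V V′ g (s₁ , s₂) V≤V′ =
    (λ d → Data.Sum.map (λ s → SynCont⇒Monotone φ D V V′ (extend d g) s V≤V′)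
                        (NoB-invariant ψ (≤⇒AgreeOff V≤V′) (extend d g)) (s₁ d)) ,
    NoB-invariant (allInf p ψ) (≤⇒AgreeOff V≤V′) g s₂

  FiniteBelow : {D : Set} → Val k D → Set₁
  FiniteBelow {D} V = Σ (Val k D) λ U → U ≤ω[ B ] V

  module _ {D : Set} {V : Val k D} where

    offB : FiniteBelow V
    offB = (λ a d → V a d × a ∉ B) ,
           (λ a → (λ _ _ → proj₁) , (λ a∉B _ → mk⇔ proj₁ (_, a∉B))) ,
           (λ b b∈B → [] , λ _ (_ , b∉B) → ⊥-elim (b∉B b∈B))

    _⊔ᵛ_ : FiniteBelow V → FiniteBelow V → FiniteBelow V
    (U₁ , U₁≤V , fin₁) ⊔ᵛ (U₂ , U₂≤V , fin₂) = (λ a d → U₁ a d ⊎ U₂ a d) ,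
      (λ a → (λ a∈B d → Data.Sum.[ proj₁ (U₁≤V a) a∈B d , proj₁ (U₂≤V a) a∈B d ]) ,
             (λ a∉B d → mk⇔ Data.Sum.[ to (proj₂ (U₁≤V a) a∉B d) , to (proj₂ (U₂≤V a) a∉B d) ]
                            (inj₁ ∘ from (proj₂ (U₁≤V a) a∉B d)))) ,
      (λ b b∈B → Finite-∪ (fin₁ b b∈B) (fin₂ b b∈B))

    ⊔ᵛ-upperˡ : (U₁ U₂ : FiniteBelow V) → proj₁ U₁ ≤[ B ] proj₁ (U₁ ⊔ᵛ U₂)
    ⊔ᵛ-upperˡ (_ , U₁≤V , _) (_ , U₂≤V , _) a = (λ _ _ → inj₁) ,
      λ a∉B d → mk⇔ inj₁ Data.Sum.[ id , from (proj₂ (U₁≤V a) a∉B d) ∘ to (proj₂ (U₂≤V a) a∉B d) ]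

    ⊔ᵛ-upperʳ : (U₁ U₂ : FiniteBelow V) → proj₁ U₂ ≤[ B ] proj₁ (U₁ ⊔ᵛ U₂)
    ⊔ᵛ-upperʳ (_ , U₁≤V , _) (_ , U₂≤V , _) a = (λ _ _ → inj₂) ,
      λ a∉B d → mk⇔ inj₂ Data.Sum.[ from (proj₂ (U₂≤V a) a∉B d) ∘ to (proj₂ (U₁≤V a) a∉B d) , id ]

    ⨆ᵛ : List (FiniteBelow V) → FiniteBelow V
    ⨆ᵛ [] = offB
    ⨆ᵛ (U ∷ Us) = U ⊔ᵛ ⨆ᵛ Us

    ⨆ᵛ-upper : ∀ Us {U} → U ∈ Us → proj₁ U ≤[ B ] proj₁ (⨆ᵛ Us)
    ⨆ᵛ-upper (U ∷ Us) (here refl) = ⊔ᵛ-upperˡ U (⨆ᵛ Us)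
    ⨆ᵛ-upper (U ∷ Us) (there U∈Us) = ≤-trans′ (⨆ᵛ-upper Us U∈Us) (⊔ᵛ-upperʳ U (⨆ᵛ Us))

  offB∪point : ∀ {D : Set} {V : Val k D} {b} → b ∈s B → ∀ {d} → V b d → Σ (FiniteBelow V) λ U → proj₁ U b d
  offB∪point {D} {V} {b} b∈B {d} Vbd = (U , U≤V , U-finite) , inj₂ (refl , refl)
    where
      U : Val k D
      U a y = (V a y × a ∉ B) ⊎ (a ≡ b × y ≡ d)
      U≤V : U ≤[ B ] V
      U≤V a = (λ a∈B y → Data.Sum.[ proj₁ , (λ { (refl , refl) → Vbd }) ]) ,
              (λ a∉B y → mk⇔ Data.Sum.[ proj₁ , (λ { (refl , _) → ⊥-elim (a∉B b∈B) }) ] (λ v → inj₁ (v , a∉B)))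
      U-finite : ∀ b′ → b′ ∈s B → Finite (U b′)
      U-finite b′ b′∈B = d ∷ [] , λ { y (inj₁ (_ , b′∉B)) → ⊥-elim (b′∉B b′∈B) ; y (inj₂ (_ , refl)) → here refl }

  module _ (lem : LEM) where
    open Classical lem

    SynCont⇒finitelySupported : ∀ {L n} {φ : Fm L k n} → SynCont B φ → ∀ (D : Set) (V : Val k D) g →
                                Sat D V φ g → Σ (Val k D) λ U → U ≤ω[ B ] V × Sat D U φ g
    SynCont⇒finitelySupported (base ψ) D V g s =
      proj₁ offB , proj₂ offB , NoB-invariant ψ (AgreeOff-sym (≤⇒AgreeOff (proj₁ (proj₂ (offB {V = V}))))) g s
    SynCont⇒finitelySupported (atom b∈B) D V g s = let U , Ub = offB∪point b∈B s in proj₁ U , proj₂ U , Ub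
    SynCont⇒finitelySupported (and φ₁ φ₂) D V g (s₁ , s₂)
      with SynCont⇒finitelySupported φ₁ D V g s₁ | SynCont⇒finitelySupported φ₂ D V g s₂
    ... | U₁ , U₁≤V , t₁ | U₂ , U₂≤V , t₂ =
      let U = (U₁ , U₁≤V) ⊔ᵛ (U₂ , U₂≤V) in proj₁ U , proj₂ U ,
      SynCont⇒Monotone φ₁ D U₁ _ g t₁ (⊔ᵛ-upperˡ (U₁ , U₁≤V) (U₂ , U₂≤V)) ,
      SynCont⇒Monotone φ₂ D U₂ _ g t₂ (⊔ᵛ-upperʳ (U₁ , U₁≤V) (U₂ , U₂≤V))
    SynCont⇒finitelySupported (or φ₁ _) D V g (inj₁ s) =
      let U , U≤V , t = SynCont⇒finitelySupported φ₁ D V g s in U , U≤V , inj₁ t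
    SynCont⇒finitelySupported (or _ φ₂) D V g (inj₂ s) =
      let U , U≤V , t = SynCont⇒finitelySupported φ₂ D V g s in U , U≤V , inj₂ t
    SynCont⇒finitelySupported (ex φ) D V g (d , s) =
      let U , U≤V , t = SynCont⇒finitelySupported φ D V (extend d g) s in U , U≤V , d , t
    SynCont⇒finitelySupported (w p {φ} {ψ} φ′ ψ′) D V g (s₁ , s₂@(xs , ¬ψ⊆xs)) =
      proj₁ U , proj₂ U , sat₁ , NoB-invariant (allInf p ψ′) (AgreeOff-sym agree) g s₂
      where
        support : D → FiniteBelow V
        support d with s₁ d
        ... | inj₁ s = let U , U≤V , _ = SynCont⇒finitelySupported φ′ D V (extend d g) s in U , U≤V
        ... | inj₂ _ = offB
        U : FiniteBelow V
        U = ⨆ᵛ (L.map support xs)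
        agree : AgreeOff (proj₁ U) V
        agree = ≤⇒AgreeOff (proj₁ (proj₂ U))
        sat₁ : ∀ d → Sat D (proj₁ U) φ (extend d g) ⊎ Sat D (proj₁ U) ψ (extend d g)
        sat₁ d with decide (Sat D V ψ (extend d g))
        ... | yes ψd = inj₂ (NoB-invariant ψ′ (AgreeOff-sym agree) (extend d g) ψd)
        ... | no ¬ψd with s₁ d | ⨆ᵛ-upper (L.map support xs) (∈-map⁺ support (¬ψ⊆xs d ¬ψd))
        ...   | inj₁ s | support≤U = inj₁ (SynCont⇒Monotone φ′ D _ _ (extend d g)
          (proj₂ (proj₂ (SynCont⇒finitelySupported φ′ D V (extend d g) s))) support≤U)
        ...   | inj₂ ψd | _ = ⊥-elim (¬ψd ψd)

    SynCont⇒Continuous : ∀ {L n} {φ : Fm L k n} → SynCont B φ → Continuous B φ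
    SynCont⇒Continuous φ = SynCont⇒Monotone φ , SynCont⇒finitelySupported φ

-- Finite conjunctions and disjunctions

module Connectives {L : Lang} {k : ℕ} where

  ⋀ : ∀ {n} {X : Set} → List X → (X → Fm L k n) → Fm L k n
  ⋀ [] f = tt′
  ⋀ (x ∷ xs) f = and (f x) (⋀ xs f)

  ⋁ : ∀ {n} {X : Set} → List X → (X → Fm L k n) → Fm L k n
  ⋁ [] f = ff′
  ⋁ (x ∷ xs) f = or (f x) (⋁ xs f)

  when : ∀ {n} → Bool → Fm L k n → Fm L k n
  when true φ = φ
  when false φ = tt′

  guard : ∀ {n} → Bool → Fm L k n → Fm L k n
  guard true φ = φ
  guard false φ = ff′

  literal : ∀ {n} → Bool → Fin k → Fin n → Fm L k n
  literal true a x = atom a x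
  literal false a x = natom a x

  ∃⁎ : ∀ ℓ → Fm L k ℓ → Fm L k 0
  ∃⁎ zero φ = φ
  ∃⁎ (suc ℓ) φ = ∃⁎ ℓ (ex φ)

  module _ {D : Set} {V : Val k D} {n : ℕ} {g : Fin n → D} where

    ⋀-sat : ∀ {X : Set} xs {f : X → Fm L k n} → Sat D V (⋀ xs f) g ⇔ (∀ x → x ∈ xs → Sat D V (f x) g)
    ⋀-sat [] = mk⇔ (λ _ _ ()) _
    ⋀-sat (y ∷ xs) = mk⇔ (λ { (s , _) _ (here refl) → s ; (_ , ss) x (there x∈) → to (⋀-sat xs) ss x x∈ })
                         (λ all → all y (here refl) , from (⋀-sat xs) λ x → all x ∘ there)

    ⋁-sat : ∀ {X : Set} xs {f : X → Fm L k n} → Sat D V (⋁ xs f) g ⇔ Σ X λ x → x ∈ xs × Sat D V (f x) g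
    ⋁-sat [] = mk⇔ (λ ()) λ { (_ , () , _) }
    ⋁-sat (y ∷ xs) = mk⇔ (λ { (inj₁ s) → y , here refl , s
                             ; (inj₂ ss) → let x , x∈ , s = to (⋁-sat xs) ss in x , there x∈ , s })
                         (λ { (_ , here refl , s) → inj₁ s
                            ; (x , there x∈ , s) → inj₂ (from (⋁-sat xs) (x , x∈ , s)) })

    when-sat : ∀ b {φ : Fm L k n} → Sat D V (when b φ) g ⇔ (T b → Sat D V φ g)
    when-sat true = mk⇔ (λ s _ → s) (λ s → s tt)
    when-sat false = mk⇔ (λ _ ()) _

    guard-sat : ∀ b {φ : Fm L k n} → Sat D V (guard b φ) g ⇔ (T b × Sat D V φ g)
    guard-sat true = mk⇔ (tt ,_) proj₂
    guard-sat false = mk⇔ (λ ()) (λ ())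

    literal-sat : ∀ b a x → Sat D V (literal b a x) g ⇔ (V a (g x) ⇔ T b)
    literal-sat true a x = mk⇔ (λ v → mk⇔ _ λ _ → v) (λ v↔t → from v↔t tt)
    literal-sat false a x = mk⇔ (λ ¬v → mk⇔ ¬v λ ()) to

    module _ (lem : LEM) where
      open Classical lem

      ⋁-dual : ∀ {X : Set} xs {f f′ : X → Fm L k n} → (∀ x → Sat D V (f′ x) g ⇔ (¬ Sat D V (f x) g)) →
               Sat D V (⋁ xs f′) g ⇔ (¬ Sat D V (⋀ xs f) g)
      ⋁-dual xs dual = mk⇔
        (λ s all → let x , x∈ , s′ = to (⋁-sat xs) s in to (dual x) s′ (to (⋀-sat xs) all x x∈))
        (λ ¬all → ¬¬-elim λ ¬any → ¬all (from (⋀-sat xs) λ x x∈ →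
                    ¬¬-elim λ ¬s → ¬any (from (⋁-sat xs) (x , x∈ , from (dual x) ¬s))))

      guard-dual : ∀ b {φ φ′ : Fm L k n} → Sat D V φ′ g ⇔ (¬ Sat D V φ g) →
                   Sat D V (guard b φ′) g ⇔ (¬ Sat D V (when b φ) g)
      guard-dual true dual = dual
      guard-dual false _ = mk⇔ (λ ()) (λ ¬tt → ¬tt tt)

      literal-dual : ∀ b a x → Sat D V (literal (not b) a x) g ⇔ (¬ Sat D V (literal b a x) g)
      literal-dual true a x = mk⇔ id id
      literal-dual false a x = mk⇔ (λ v ¬v → ¬v v) ¬¬-elim

  ∃⁎-sat : ∀ ℓ {φ : Fm L k ℓ} {D : Set} {V : Val k D} →
           Sat D V (∃⁎ ℓ φ) noVars ⇔ Σ (Fin ℓ → D) (Sat D V φ)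
  ∃⁎-sat zero {φ} = mk⇔ (noVars ,_) (λ (g , s) → Sat-cong φ (λ ()) s)
  ∃⁎-sat (suc ℓ) {φ} {D} {V} = mk⇔
    (λ s → let g , d , s′ = to (∃⁎-sat ℓ {ex φ} {D} {V}) s in extend d g , s′)
    (λ (g , s) → from (∃⁎-sat ℓ {ex φ}) (g ∘ suc , g zero , Sat-cong φ (λ { zero → refl ; (suc i) → refl }) s))

  module _ (B : Subset k) where

    ⋀-NoB : ∀ {n} {X : Set} (xs : List X) {f : X → Fm L k n} → (∀ x → NoB B (f x)) → NoB B (⋀ xs f)
    ⋀-NoB [] _ = tt′
    ⋀-NoB (x ∷ xs) f = and (f x) (⋀-NoB xs f)

    ⋁-NoB : ∀ {n} {X : Set} (xs : List X) {f : X → Fm L k n} → (∀ x → NoB B (f x)) → NoB B (⋁ xs f)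
    ⋁-NoB [] _ = ff′
    ⋁-NoB (x ∷ xs) f = or (f x) (⋁-NoB xs f)

    ⋀-SynCont : ∀ {n} {X : Set} (xs : List X) {f : X → Fm L k n} →
                (∀ x → SynCont B (f x)) → SynCont B (⋀ xs f)
    ⋀-SynCont [] _ = base tt′
    ⋀-SynCont (x ∷ xs) f = and (f x) (⋀-SynCont xs f)

    ⋁-SynCont : ∀ {n} {X : Set} (xs : List X) {f : X → Fm L k n} →
                (∀ x → SynCont B (f x)) → SynCont B (⋁ xs f)
    ⋁-SynCont [] _ = base ff′
    ⋁-SynCont (x ∷ xs) f = or (f x) (⋁-SynCont xs f)

    when-NoB : ∀ {n} b {φ : Fm L k n} → (T b → NoB B φ) → NoB B (when b φ)
    when-NoB true φ = φ tt
    when-NoB false _ = tt′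

    when-SynCont : ∀ {n} b {φ : Fm L k n} → (T b → SynCont B φ) → SynCont B (when b φ)
    when-SynCont true φ = φ tt
    when-SynCont false _ = base tt′

    guard-NoB : ∀ {n} b {φ : Fm L k n} → (T b → NoB B φ) → NoB B (guard b φ)
    guard-NoB true φ = φ tt
    guard-NoB false _ = ff′

    guard-SynCont : ∀ {n} b {φ : Fm L k n} → (T b → SynCont B φ) → SynCont B (guard b φ)
    guard-SynCont true φ = φ tt
    guard-SynCont false _ = base ff′

    literal-NoB : ∀ {n} b {a} (x : Fin n) → a ∉ B → NoB B (literal b a x)
    literal-NoB true x a∉B = atom a∉B
    literal-NoB false x a∉B = natom a∉B

    ∃⁎-SynCont : ∀ ℓ {φ : Fm L k ℓ} → SynCont B φ → SynCont B (∃⁎ ℓ φ)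
    ∃⁎-SynCont zero φ = φ
    ∃⁎-SynCont (suc ℓ) φ = ∃⁎-SynCont ℓ (ex φ)

-- Describing colours outside and inside B

module ColourFormulas {k : ℕ} (B : Subset k) where

  inB : Fin k → Bool
  inB = lookup B

  inB⇔∈ : ∀ {a} → T (inB a) ⇔ a ∈s B
  inB⇔∈ {a} = mk⇔ (VP.lookup⇒[]= a B ∘ to T-≡) (from T-≡ ∘ VP.[]=⇒lookup)

  free? : Colour k → Bool
  free? c = not (anyᵇ (λ a → inB a ∧ lookup c a) (L.allFin k))

  free?-correct : ∀ c → T (free? c) ⇔ (∀ a → T (inB a) → ¬ T (lookup c a))
  free?-correct c = ⇔.trans T-not (mk⇔
    (λ ¬some a a∈B ca → ¬some (from (T-any-complete ∈-allFin _) (a , from T-∧ (a∈B , ca))))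
    (λ none some → let a , t = to (T-any-complete ∈-allFin _) some ; a∈B , ca = to T-∧ t
                   in none a a∈B ca))

  free⇒¬B : ∀ c → T (free? c) → ∀ a → ¬ T (inB a ∧ lookup c a)
  free⇒¬B c c-free a t = let a∈B , ca = to T-∧ t in to (free?-correct c) c-free a a∈B ca

  nonfree-letter : ∀ c → ¬ T (free? c) → Σ (Fin k) λ a → T (inB a ∧ lookup c a)
  nonfree-letter c nonfree = to (T-any-complete ∈-allFin _) (decidable-stable (T? _) (nonfree ∘ from T-not))

  eraseB : Colour k → Colour k
  eraseB c = V.tabulate λ a → not (inB a) ∧ lookup c a

  lookup-eraseB : ∀ c a → lookup (eraseB c) a ≡ not (inB a) ∧ lookup c a
  lookup-eraseB c a = VP.lookup∘tabulate _ a

  eraseB-free : ∀ c → T (free? (eraseB c))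
  eraseB-free c = from (free?-correct (eraseB c)) λ a a∈B t → to (T-not {inB a})
    (proj₁ (to T-∧ (subst T (lookup-eraseB c a) t))) a∈B

  eraseB-off : ∀ c {a} → T (not (inB a)) → lookup (eraseB c) a ≡ lookup c a
  eraseB-off c {a} a∉B = trans (lookup-eraseB c a) (cong (_∧ lookup c a) (to T-≡ a∉B))

  eraseB-free-id : ∀ {c} → T (free? c) → eraseB c ≡ c
  eraseB-free-id {c} c-free = Colour-ext λ a → trans (lookup-eraseB c a) (on a (inB a) refl)
    where
      on : ∀ a b → inB a ≡ b → not b ∧ lookup c a ≡ lookup c a
      on a false _ = refl
      on a true a∈B = T⇔⇒≡ (λ ()) λ ca → to (free?-correct c) c-free a (subst T (sym a∈B) tt) ca

  eraseB-idem : ∀ c → eraseB (eraseB c) ≡ eraseB c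
  eraseB-idem c = eraseB-free-id (eraseB-free c)

  saturates? : ℕ → Card → Colour k → Colour k → Bool
  saturates? N x e c = not (free? c) ∧ (full? N x ∧ isYes (eraseB c ≟ᶜ eraseB e))

  saturates?-correct : ∀ N x e c →
                       T (saturates? N x e c) ⇔ (¬ T (free? c) × x ≡ fin N × eraseB c ≡ eraseB e)
  saturates?-correct N x e c =
    ⇔.trans T-∧ (T-not {free? c} ×-⇔ ⇔.trans T-∧ (full?-correct ×-⇔ mk⇔ toWitness fromWitness))

  module _ {D : Set} (V : Val k D) where

    PositiveB : D → Colour k → Set
    PositiveB d c = ∀ a → T (inB a ∧ lookup c a) → V a d

    AgreesOffB : D → Colour k → Set
    AgreesOffB d c = ∀ a → T (not (inB a)) → V a d ⇔ T (lookup c a)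

    AgreesOffB-resp : ∀ {d} c c′ → eraseB c ≡ eraseB c′ → AgreesOffB d c → AgreesOffB d c′
    AgreesOffB-resp {d} c c′ same agree a a∉B = subst (λ b → V a d ⇔ T b) lookups (agree a a∉B)
      where
        lookups : lookup c a ≡ lookup c′ a
        lookups = trans (sym (eraseB-off c a∉B)) (trans (cong (λ c → lookup c a) same) (eraseB-off c′ a∉B))

    AgreesOffB-unique : ∀ {d} c c′ → AgreesOffB d c → AgreesOffB d c′ → eraseB c ≡ eraseB c′
    AgreesOffB-unique {d} c c′ agree agree′ = Colour-ext λ a →
      trans (lookup-eraseB c a) (trans (on a (inB a) refl) (sym (lookup-eraseB c′ a)))
      where
        on : ∀ a b → inB a ≡ b → not b ∧ lookup c a ≡ not b ∧ lookup c′ a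
        on a true _ = refl
        on a false a∉B = let off = subst (T ∘ not) (sym a∉B) tt in
          T⇔⇒≡ (to (agree′ a off) ∘ from (agree a off)) (to (agree a off) ∘ from (agree′ a off))

    HasColour⇒AgreesOffB : ∀ {d c} → HasColour V d c → AgreesOffB d c
    HasColour⇒AgreesOffB (hasColour at) a _ = at a

  module Refinement {D : Set} {U V : Val k D} (U≤V : U ≤ω[ B ] V) where

    colour-positive : ∀ {c d} → HasColour U d c → PositiveB V d c
    colour-positive (hasColour at) a t = let a∈B , ca = to T-∧ t in
      proj₁ (proj₁ U≤V a) (to inB⇔∈ a∈B) _ (from (at a) ca)

    colour-agrees : ∀ {c d} → HasColour U d c → AgreesOffB V d c
    colour-agrees (hasColour at) a a∉B =
      ⇔.trans (⇔.sym (proj₂ (proj₁ U≤V a) (to (T-not {inB a}) a∉B ∘ from inB⇔∈) _)) (at a)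

    BSupport : D → Set
    BSupport d = Σ (Fin k) λ b → b ∈ L.allFin k × (T (inB b) × U b d)

    BSupport-finite : Finite BSupport
    BSupport-finite = Finite-⋃ (L.allFin k) λ b → case T? (inB b) of λ
      { (yes b∈B) → Finite-⊆ (λ _ → proj₂) (proj₂ U≤V b (to inB⇔∈ b∈B))
      ; (no b∉B) → [] , λ _ (b∈B , _) → ⊥-elim (b∉B b∈B) }

    nonfree-BSupport : ∀ c {d} → ¬ T (free? c) → HasColour U d c → BSupport d
    nonfree-BSupport c nonfree (hasColour at) =
      let b , t = nonfree-letter c nonfree ; b∈B , cb = to T-∧ t in b , ∈-allFin b , b∈B , from (at b) cb

  module Erasure (lem : LEM) {D : Set} (V : Val k D) where

    erase : D → Colour k
    erase d = eraseB (colourOf lem V d)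

    erase-free : ∀ d → T (free? (erase d))
    erase-free d = eraseB-free (colourOf lem V d)

    erase-agrees : ∀ d → AgreesOffB V d (erase d)
    erase-agrees d = AgreesOffB-resp V (colourOf lem V d) (erase d) (sym (eraseB-idem (colourOf lem V d)))
                                     (HasColour⇒AgreesOffB V (colourOf-correct lem V d))

    erase-unique : ∀ {d e} → T (free? e) → AgreesOffB V d e → erase d ≡ e
    erase-unique {d} {e} e-free agree = begin
      erase d           ≡⟨ eraseB-free-id (erase-free d) ⟨
      eraseB (erase d)  ≡⟨ AgreesOffB-unique V (erase d) e (erase-agrees d) agree ⟩
      eraseB e          ≡⟨ eraseB-free-id e-free ⟩
      e                 ∎
      where open ≡-Reasoning

  module Formulas {L : Lang} where
    open Connectives {L} {k}

    positiveB : ∀ {n} → Colour k → Fin n → Fm L k n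
    positiveB c x = ⋀ (L.allFin k) λ a → when (inB a ∧ lookup c a) (atom a x)

    agreeOffB : ∀ {n} → Colour k → Fin n → Fm L k n
    agreeOffB c x = ⋀ (L.allFin k) λ a → when (not (inB a)) (literal (lookup c a) a x)

    disagreeOffB : ∀ {n} → Colour k → Fin n → Fm L k n
    disagreeOffB c x = ⋁ (L.allFin k) λ a → guard (not (inB a)) (literal (not (lookup c a)) a x)

    positiveB-SynCont : ∀ {n} c (x : Fin n) → SynCont B (positiveB c x)
    positiveB-SynCont c x = ⋀-SynCont B (L.allFin k) λ a →
      when-SynCont B (inB a ∧ _) λ t → atom (to inB⇔∈ (proj₁ (to T-∧ t)))

    agreeOffB-NoB : ∀ {n} c (x : Fin n) → NoB B (agreeOffB c x)
    agreeOffB-NoB c x = ⋀-NoB B (L.allFin k) λ a →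
      when-NoB B (not (inB a)) λ t → literal-NoB B _ x (to (T-not {inB a}) t ∘ from inB⇔∈)

    disagreeOffB-NoB : ∀ {n} c (x : Fin n) → NoB B (disagreeOffB c x)
    disagreeOffB-NoB c x = ⋁-NoB B (L.allFin k) λ a →
      guard-NoB B (not (inB a)) λ t → literal-NoB B _ x (to (T-not {inB a}) t ∘ from inB⇔∈)

    module _ {D : Set} {V : Val k D} {n : ℕ} {g : Fin n → D} where

      positiveB-sat : ∀ c x → Sat D V (positiveB c x) g ⇔ PositiveB V (g x) c
      positiveB-sat c x = ⇔.trans (⋀-sat _) (mk⇔
        (λ all a → to (when-sat _) (all a (∈-allFin a)))
        (λ pos a _ → from (when-sat _) (pos a)))

      agreeOffB-sat : ∀ c x → Sat D V (agreeOffB c x) g ⇔ AgreesOffB V (g x) c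
      agreeOffB-sat c x = ⇔.trans (⋀-sat _) (mk⇔
        (λ all a off → to (literal-sat _ a x) (to (when-sat _) (all a (∈-allFin a)) off))
        (λ agree a _ → from (when-sat _) (from (literal-sat _ a x) ∘ agree a)))

      disagreeOffB-sat : LEM → ∀ c x → Sat D V (disagreeOffB c x) g ⇔ (¬ AgreesOffB V (g x) c)
      disagreeOffB-sat lem c x = ⇔.trans
        (⋁-dual lem (L.allFin k) λ a → guard-dual lem (not (inB a)) (literal-dual lem (lookup c a) a x))
        (¬-cong (agreeOffB-sat c x))

-- Characteristic sentences in ME∞

headed : ∀ {k} → Bool → (Colour (suc k) → ℕ) → Colour k → ℕ
headed b count = count ∘ (b ∷_)

#slots : ∀ {k} → (Colour k → ℕ) → ℕ
#slots {zero} count = count []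
#slots {suc k} count = #slots (headed true count) + #slots (headed false count)

decode : ∀ {k} (count : Colour k → ℕ) → Fin (#slots count) → Σ (Colour k) (Fin ∘ count)
decode {zero} count i = [] , i
decode {suc k} count i with F.splitAt (#slots (headed true count)) i
... | inj₁ j = let c , t = decode (headed true count) j in true ∷ c , t
... | inj₂ j = let c , t = decode (headed false count) j in false ∷ c , t

encode : ∀ {k} (count : Colour k → ℕ) (c : Colour k) → Fin (count c) → Fin (#slots count)
encode {zero} count [] t = t
encode {suc k} count (true ∷ c) t = encode (headed true count) c t F.↑ˡ #slots (headed false count)
encode {suc k} count (false ∷ c) t = #slots (headed true count) F.↑ʳ encode (headed false count) c t

decode-encode : ∀ {k} (count : Colour k → ℕ) c t → decode count (encode count c t) ≡ (c , t)
decode-encode {zero} count [] t = refl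
decode-encode {suc k} count (true ∷ c) t
  rewrite splitAt-↑ˡ (#slots (headed true count)) (encode (headed true count) c t) (#slots (headed false count))
        | decode-encode (headed true count) c t = refl
decode-encode {suc k} count (false ∷ c) t
  rewrite splitAt-↑ʳ (#slots (headed true count)) (#slots (headed false count)) (encode (headed false count) c t)
        | decode-encode (headed false count) c t = refl

encode-decode : ∀ {k} (count : Colour k → ℕ) i → let c , t = decode count i in encode count c t ≡ i
encode-decode {zero} count i = refl
encode-decode {suc k} count i with F.splitAt (#slots (headed true count)) i in split
... | inj₁ j = trans (cong (F._↑ˡ #slots (headed false count)) (encode-decode (headed true count) j))
                     (trans (cong (F.join _ _) (sym split)) (join-splitAt (#slots (headed true count)) _ i))
... | inj₂ j = trans (cong (#slots (headed true count) F.↑ʳ_) (encode-decode (headed false count) j))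
                     (trans (cong (F.join _ _) (sym split)) (join-splitAt (#slots (headed true count)) _ i))

encode-injective : ∀ {k} (count : Colour k → ℕ) c {t t′} → encode count c t ≡ encode count c t′ → t ≡ t′
encode-injective {k} count c {t} {t′} same = snd-≡ (begin
  (c , t)                          ≡⟨ decode-encode count c t ⟨
  decode count (encode count c t)  ≡⟨ cong (decode count) same ⟩
  decode count (encode count c t′) ≡⟨ decode-encode count c t′ ⟩
  (c , t′)                         ∎)
  where
    open ≡-Reasoning
    snd-≡ : ∀ {t t′ : Fin (count c)} → _≡_ {A = Σ (Colour k) (Fin ∘ count)} (c , t) (c , t′) → t ≡ t′
    snd-≡ refl = refl

finitePart : Card → ℕ
finitePart (fin m) = m
finitePart ∞ = 0

-- χ describes a U ≤ω V with counts π from the point of view of V: the variables name the finitely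
-- counted elements of every colour. An element agreeing outside B with a B-free colour e belongs in U
-- either to e or to a colour c ≥ e with B-letters; the latter are finitely many. So V must contain
-- infinitely many such elements if π e = ∞, finitely many if π e is full, and if π e is small, all but
-- the named ones must be promotable to a full colour c whose B-letters they carry.
module Characteristic {k : ℕ} (B : Subset k) (N : ℕ) (π : Colour k → Card) where
  open ColourFormulas B
  open Formulas {MEinf}
  open Connectives {MEinf} {k}

  count : Colour k → ℕ
  count = finitePart ∘ π

  ℓ : ℕ
  ℓ = #slots count

  slotColour : Fin ℓ → Colour k
  slotColour = proj₁ ∘ decode count

  Distinct : Fm MEinf k ℓ
  Distinct = ⋀ (L.allFin ℓ) λ i → ⋀ (L.allFin ℓ) λ j → when (not (isYes (i F.≟ j))) (neq tt i j)

  Labelled : Fm MEinf k ℓ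
  Labelled = ⋀ (L.allFin ℓ) λ i → and (positiveB (slotColour i) i) (agreeOffB (slotColour i) i)

  Promotable : Colour k → Fm MEinf k (suc ℓ)
  Promotable e =
    and (agreeOffB e zero) (⋁ (allColours k) λ c → guard (saturates? N (π c) e c) (positiveB c zero))

  Exempt : Colour k → Fm MEinf k (suc ℓ)
  Exempt e = or (disagreeOffB e zero) (⋁ (L.allFin ℓ) λ i → eq tt zero (suc i))

  RestFin : Bool → Colour k → Fm MEinf k ℓ
  RestFin true e = W tt (Promotable e) (Exempt e)
  RestFin false e = allInf tt (disagreeOffB e zero)

  Rest : Card → Colour k → Fm MEinf k ℓ
  Rest ∞ e = exInf tt (agreeOffB e zero)
  Rest (fin m) e = RestFin (m <ᵇ N) e

  Rests : Fm MEinf k ℓ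
  Rests = ⋀ (allColours k) λ e → when (free? e) (Rest (π e) e)

  χ : Sentence MEinf k
  χ = ∃⁎ ℓ (and Distinct (and Labelled Rests))

  χ-SynCont : SynCont B χ
  χ-SynCont = ∃⁎-SynCont B ℓ (and (base distinct-NoB) (and labelled rests))
    where
      distinct-NoB : NoB B Distinct
      distinct-NoB = ⋀-NoB B (L.allFin ℓ) λ i → ⋀-NoB B (L.allFin ℓ) λ j → when-NoB B _ λ _ → neq tt i j
      labelled : SynCont B Labelled
      labelled = ⋀-SynCont B (L.allFin ℓ) λ i →
        and (positiveB-SynCont (slotColour i) i) (base (agreeOffB-NoB (slotColour i) i))
      restFin : ∀ b e → SynCont B (RestFin b e)
      restFin true e = w tt (and (base (agreeOffB-NoB e zero))
                                 (⋁-SynCont B (allColours k) λ c → guard-SynCont B _ λ _ → positiveB-SynCont c zero))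
                            (or (disagreeOffB-NoB e zero) (⋁-NoB B (L.allFin ℓ) λ i → eq tt zero (suc i)))
      restFin false e = base (allInf tt (disagreeOffB-NoB e zero))
      rest : ∀ x e → SynCont B (Rest x e)
      rest ∞ e = base (exInf tt (agreeOffB-NoB e zero))
      rest (fin m) e = restFin (m <ᵇ N) e
      rests : SynCont B Rests
      rests = ⋀-SynCont B (allColours k) λ e → when-SynCont B _ λ _ → rest (π e) e

module CharacteristicComplete (lem : LEM) {k : ℕ} (B : Subset k) (N : ℕ) (π : Colour k → Card)
         (π-capped : ∀ c → π c ∈ cards≤ N)
         {D : Set} {V U : Val k D} (U≤V : U ≤ω[ B ] V) (counts : ColourCounts N U π) where
  open Classical lem
  open Characteristic B N π
  open ColourFormulas B
  open Formulas {MEinf}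
  open Connectives {MEinf} {k}
  open Refinement U≤V

  Class : Colour k → D → Set
  Class c d = HasColour U d c

  witnesses : ∀ c → AtLeast (Class c) (count c)
  witnesses c = on (π c) (counts c) (π-capped c)
    where
      on : ∀ x → HasCard N (Class c) x → x ∈ cards≤ N → AtLeast (Class c) (finitePart x)
      on ∞ _ _ = AtLeast-zero
      on (fin m) (_ , atLeast , _) m∈ = subst (AtLeast _) (m≤n⇒m⊓n≡m (cards≤-fin m∈)) atLeast

  pick : ∀ c → Fin (count c) → D
  pick c = AtLeast.elem (witnesses c)

  g : Fin ℓ → D
  g i = let c , t = decode count i in pick c t

  pick-injective : ∀ {c c′ t t′} → pick c t ≡ pick c′ t′ →
                   _≡_ {A = Σ (Colour k) (Fin ∘ count)} (c , t) (c′ , t′)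
  pick-injective {c} {c′} {t} {t′} same
    with HasColour-unique (AtLeast.elem-satisfies (witnesses c) t)
                          (subst (λ d → Class c′ d) (sym same) (AtLeast.elem-satisfies (witnesses c′) t′))
  ... | refl = cong (c ,_) (AtLeast.elem-injective (witnesses c) same)

  g-injective : Injective _≡_ _≡_ g
  g-injective {i} {j} same = begin
    i                                       ≡⟨ encode-decode count i ⟨
    uncurry (encode count) (decode count i) ≡⟨ cong (uncurry (encode count)) (pick-injective same) ⟩
    uncurry (encode count) (decode count j) ≡⟨ encode-decode count j ⟩
    j                                       ∎
    where open ≡-Reasoning

  g-class : ∀ i → Class (slotColour i) (g i)
  g-class i = AtLeast.elem-satisfies (witnesses _) _

  g-encode : ∀ c t → g (encode count c t) ≡ pick c t
  g-encode c t = cong (uncurry pick) (decode-encode count c t)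

  nonfree-class-finite : ∀ {c} → ¬ T (free? c) → Finite (Class c)
  nonfree-class-finite {c} nonfree = Finite-⊆ (λ _ → nonfree-BSupport c nonfree) BSupport-finite

  admissible : ∀ c → T (infinite? (π c)) → T (free? c)
  admissible c inf = decidable-stable (T? _) λ nonfree →
    HasCard-infinite (π c) inf (counts c) (nonfree-class-finite nonfree)

  free-class : ∀ {d e} → T (free? e) → AgreesOffB V d e → T (free? (colourOf lem U d)) → Class e d
  free-class {d} {e} e-free agree c-free = subst (λ c → Class c d) colour≡e (colourOf-correct lem U d)
    where
      colour≡e : colourOf lem U d ≡ e
      colour≡e = begin
        colourOf lem U d          ≡⟨ eraseB-free-id c-free ⟨
        eraseB (colourOf lem U d) ≡⟨ AgreesOffB-unique V (colourOf lem U d) e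
                                        (colour-agrees (colourOf-correct lem U d)) agree ⟩
        eraseB e                  ≡⟨ eraseB-free-id e-free ⟩
        e                         ∎
        where open ≡-Reasoning

  agreeing-finite : ∀ e → T (free? e) → Finite (Class e) → Finite (λ d → AgreesOffB V d e)
  agreeing-finite e e-free class-finite = Finite-⊆ sort (Finite-∪ class-finite BSupport-finite)
    where
      sort : ∀ d → AgreesOffB V d e → Class e d ⊎ BSupport d
      sort d agree with T? (free? (colourOf lem U d))
      ... | yes c-free = inj₁ (free-class e-free agree c-free)
      ... | no nonfree = inj₂ (nonfree-BSupport _ nonfree (colourOf-correct lem U d))

  named-if-small : ∀ {c m d} → π c ≡ fin m → m < N → Class c d → Σ (Fin ℓ) λ i → g i ≡ d
  named-if-small {c} π≡m m<N d∶c =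
    let atMost = proj₂ (proj₂ (subst (HasCard N (Class c)) π≡m (counts c))) m<N
        t , pick≡d = AtLeast-exhausts lem (subst (AtMost (Class c) ∘ finitePart) (sym π≡m) atMost) (witnesses c) d∶c
    in encode count c t , trans (g-encode c t) pick≡d

  exempt-named : ∀ {e d} → Σ (Fin ℓ) (λ i → g i ≡ d) → Sat D V (Exempt e) (extend d g)
  exempt-named (i , refl) = inj₂ (from (⋁-sat (L.allFin ℓ)) (i , ∈-allFin i , refl))

  exempt-disagrees : ∀ {e d} → ¬ AgreesOffB V d e → Sat D V (Exempt e) (extend d g)
  exempt-disagrees {e} disagree = inj₁ (from (disagreeOffB-sat lem e zero) disagree)

  promotable : ∀ {e d c} → AgreesOffB V d e → Class c d → ¬ T (free? c) → π c ≡ fin N →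
               Sat D V (Promotable e) (extend d g)
  promotable {e} {d} {c} agree d∶c nonfree π≡N = from (agreeOffB-sat e zero) agree ,
    from (⋁-sat (allColours k)) (c , ∈-allColours c , from (guard-sat _)
      (from (saturates?-correct N (π c) e c) (nonfree , π≡N , AgreesOffB-unique V c e (colour-agrees d∶c) agree) ,
       from (positiveB-sat c zero) (colour-positive d∶c)))

  promotable-or-exempt : ∀ {e m} → T (free? e) → π e ≡ fin m → m < N →
                       ∀ d → Sat D V (Promotable e) (extend d g) ⊎ Sat D V (Exempt e) (extend d g)
  promotable-or-exempt {e} e-free π≡m m<N d with decide (AgreesOffB V d e)
  ... | no disagree = inj₂ (exempt-disagrees {e} disagree)
  ... | yes agree with T? (free? (colourOf lem U d))
  ...   | yes c-free = inj₂ (exempt-named {e} (named-if-small π≡m m<N (free-class e-free agree c-free)))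
  ...   | no nonfree = promote-nonfree (π c) refl
    where
      c : Colour k
      c = colourOf lem U d
      d∶c : HasColour U d c
      d∶c = colourOf-correct lem U d
      promote-nonfree : ∀ x → π c ≡ x → Sat D V (Promotable e) (extend d g) ⊎ Sat D V (Exempt e) (extend d g)
      promote-nonfree ∞ π≡∞ = ⊥-elim (nonfree (admissible c (subst (T ∘ infinite?) (sym π≡∞) tt)))
      promote-nonfree (fin m′) π≡m′ with m≤n⇒m<n∨m≡n (cards≤-fin (subst (_∈ cards≤ N) π≡m′ (π-capped c)))
      ... | inj₁ m′<N = inj₂ (exempt-named {e} (named-if-small π≡m′ m′<N d∶c))
      ... | inj₂ m′≡N = inj₁ (promotable {e} agree d∶c nonfree (trans π≡m′ (cong fin m′≡N)))

  ¬disagreeing-finite : ∀ {e m} → T (free? e) → π e ≡ fin m →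
                        Finite (λ d → ¬ Sat D V (disagreeOffB e zero) (extend d g))
  ¬disagreeing-finite {e} e-free π≡m =
    Finite-⊆ (λ d → ¬¬-elim ∘ (_∘ from (disagreeOffB-sat lem e zero)))
             (agreeing-finite e e-free (proj₁ (subst (HasCard N (Class e)) π≡m (counts e))))

  rest-sat : ∀ e → T (free? e) → Sat D V (Rest (π e) e) g
  rest-sat e e-free = on (π e) refl
    where
      on : ∀ x → π e ≡ x → Sat D V (Rest x e) g
      on ∞ π≡∞ finite = subst (HasCard N (Class e)) π≡∞ (counts e)
        (Finite-⊆ (λ d d∶e → from (agreeOffB-sat e zero) (colour-agrees d∶e)) finite)
      on (fin m) π≡m with m <ᵇ N in small
      ... | false = ¬disagreeing-finite e-free π≡m
      ... | true = promotable-or-exempt e-free π≡m (<ᵇ⇒< m N (subst T (sym small) tt)) ,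
                   Finite-⊆ (λ d ¬exempt → ¬exempt ∘ inj₁) (¬disagreeing-finite e-free π≡m)

  χ-sat : Sat D V χ noVars
  χ-sat = from (∃⁎-sat ℓ) (g , distinct-sat , labelled-sat , rests-sat)
    where
      distinct-sat : Sat D V Distinct g
      distinct-sat = from (⋀-sat (L.allFin ℓ)) λ i _ → from (⋀-sat (L.allFin ℓ)) λ j _ →
        from (when-sat _) λ i≢j same → to (T-not {isYes (i F.≟ j)}) i≢j (fromWitness (g-injective same))
      labelled-sat : Sat D V Labelled g
      labelled-sat = from (⋀-sat (L.allFin ℓ)) λ i _ →
        from (positiveB-sat (slotColour i) i) (colour-positive (g-class i)) ,
        from (agreeOffB-sat (slotColour i) i) (colour-agrees (g-class i))
      rests-sat : Sat D V Rests g
      rests-sat = from (⋀-sat (allColours k)) λ e _ → from (when-sat _) (rest-sat e)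

module CharacteristicSound (lem : LEM) {k : ℕ} (B : Subset k) (N : ℕ) (π : Colour k → Card)
         (admissible : ∀ c → T (infinite? (π c)) → T (ColourFormulas.free? B c))
         {D : Set} {V : Val k D} (sat : Sat D V (Characteristic.χ B N π) noVars) where
  open Classical lem
  open Characteristic B N π
  open ColourFormulas B
  open Erasure lem V
  open Formulas {MEinf}
  open Connectives {MEinf} {k}

  g : Fin ℓ → D
  g = proj₁ (to (∃⁎-sat ℓ) sat)

  distinct-sat : Sat D V Distinct g
  distinct-sat = proj₁ (proj₂ (to (∃⁎-sat ℓ) sat))

  labelled-sat : Sat D V Labelled g
  labelled-sat = proj₁ (proj₂ (proj₂ (to (∃⁎-sat ℓ) sat)))

  g-injective : Injective _≡_ _≡_ g
  g-injective {i} {j} same = decidable-stable (i F.≟ j) λ i≢j →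
    to (when-sat _) (to (⋀-sat (L.allFin ℓ)) (to (⋀-sat (L.allFin ℓ)) distinct-sat i (∈-allFin i)) j (∈-allFin j))
                    (from (T-not {isYes (i F.≟ j)}) (i≢j ∘ toWitness)) same

  g-labelled : ∀ i → PositiveB V (g i) (slotColour i) × AgreesOffB V (g i) (slotColour i)
  g-labelled i = let pos , agree = to (⋀-sat (L.allFin ℓ)) labelled-sat i (∈-allFin i) in
    to (positiveB-sat (slotColour i) i) pos , to (agreeOffB-sat (slotColour i) i) agree

  rest-sat : ∀ e → T (free? e) → Sat D V (Rest (π e) e) g
  rest-sat e =
    to (when-sat (free? e))
       (to (⋀-sat (allColours k)) (proj₂ (proj₂ (proj₂ (to (∃⁎-sat ℓ) sat)))) e (∈-allColours e))

  Named : D → Set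
  Named d = Σ (Fin ℓ) λ i → g i ≡ d

  ¬Exempt : ∀ {e d} → ¬ Named d → AgreesOffB V d e → ¬ Sat D V (Exempt e) (extend d g)
  ¬Exempt {e} _ agree (inj₁ disagree) = to (disagreeOffB-sat lem e zero) disagree agree
  ¬Exempt ¬named _ (inj₂ s) = let i , _ , same = to (⋁-sat (L.allFin ℓ)) s in ¬named (i , sym same)

  agreeing-finite : ∀ {e m} → T (free? e) → π e ≡ fin m → Finite (λ d → AgreesOffB V d e)
  agreeing-finite {e} {m} e-free π≡m = on (m <ᵇ N) (subst (λ x → Sat D V (Rest x e) g) π≡m (rest-sat e e-free))
    where
      on : ∀ b → Sat D V (RestFin b e) g → Finite (λ d → AgreesOffB V d e)
      on true (_ , unexempt-finite) = Finite-⊆ sort (Finite-∪ (Finite-range g) unexempt-finite)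
        where
          sort : ∀ d → AgreesOffB V d e → Named d ⊎ ¬ Sat D V (Exempt e) (extend d g)
          sort d agree with decide (Named d)
          ... | yes named = inj₁ named
          ... | no ¬named = inj₂ (¬Exempt {e} ¬named agree)
      on false disagree-cofinite =
        Finite-⊆ (λ d agree disagree → to (disagreeOffB-sat lem e zero) disagree agree) disagree-cofinite

  agreeing-infinite : ∀ {e} → T (free? e) → π e ≡ ∞ → ¬ Finite (λ d → AgreesOffB V d e)
  agreeing-infinite {e} e-free π≡∞ = subst (λ x → Sat D V (Rest x e) g) π≡∞ (rest-sat e e-free) ∘
                                     Finite-⊆ (λ d → to (agreeOffB-sat e zero))

  promotable-or-exempt : ∀ {e m} → T (free? e) → π e ≡ fin m → m < N →
                       ∀ d → Sat D V (Promotable e) (extend d g) ⊎ Sat D V (Exempt e) (extend d g)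
  promotable-or-exempt {e} {m} e-free π≡m m<N = on (m <ᵇ N) (<⇒<ᵇ m<N)
    (subst (λ x → Sat D V (Rest x e) g) π≡m (rest-sat e e-free))
    where
      on : ∀ b → T b → Sat D V (RestFin b e) g →
           ∀ d → Sat D V (Promotable e) (extend d g) ⊎ Sat D V (Exempt e) (extend d g)
      on true _ (promotable-or-exempt , _) = promotable-or-exempt

  CanPromote : D → Set
  CanPromote d = T (small? N (π (erase d))) ×
                 Σ (Colour k) λ c → T (saturates? N (π c) (erase d) c) × PositiveB V d c

  data Kind (d : D) : Set where
    isNamed : Named d → Kind d
    isPromoted : ¬ Named d → CanPromote d → Kind d
    isPlain : ¬ Named d → ¬ CanPromote d → Kind d

  kind : ∀ d → Kind d
  kind d with decide (Named d) | decide (CanPromote d)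
  ... | yes d-named | _ = isNamed d-named
  ... | no ¬named | yes promote = isPromoted ¬named promote
  ... | no ¬named | no ¬promote = isPlain ¬named ¬promote

  colourOfKind : ∀ {d} → Kind d → Colour k
  colourOfKind (isNamed (i , _)) = slotColour i
  colourOfKind (isPromoted _ (_ , c , _)) = c
  colourOfKind {d} (isPlain _ _) = erase d

  β : D → Colour k
  β d = colourOfKind (kind d)

  U : Val k D
  U a d = T (lookup (β d) a)

  Special : D → Set
  Special d = Named d ⊎ ¬ T (infinite? (π (erase d)))

  special-finite : Finite Special
  special-finite = Finite-∪ (Finite-range g)
    (Finite-⊆ (λ d finite → erase d , ∈-allColours _ , erase-free d , finite , erase-agrees d)
              (Finite-⋃ (allColours k) λ e → finite-erasure e (π e) refl))
    where
      finite-erasure : ∀ e x → π e ≡ x → Finite (λ d → T (free? e) × ¬ T (infinite? (π e)) × AgreesOffB V d e)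
      finite-erasure e ∞ π≡∞ = [] , λ _ (_ , finite , _) → ⊥-elim (finite (subst (T ∘ infinite?) (sym π≡∞) tt))
      finite-erasure e (fin m) π≡m with T? (free? e)
      ... | yes e-free = Finite-⊆ (λ _ → proj₂ ∘ proj₂) (agreeing-finite e-free π≡m)
      ... | no nonfree = [] , λ _ (e-free , _) → ⊥-elim (nonfree e-free)

  module _ {d : D} where

    kind-positive : (κ : Kind d) → PositiveB V d (colourOfKind κ)
    kind-positive (isNamed (i , refl)) = proj₁ (g-labelled i)
    kind-positive (isPromoted _ (_ , _ , _ , positive)) = positive
    kind-positive (isPlain _ _) a t = ⊥-elim (free⇒¬B (erase d) (erase-free d) a t)

    kind-agrees : (κ : Kind d) → AgreesOffB V d (colourOfKind κ)
    kind-agrees (isNamed (i , refl)) = proj₂ (g-labelled i)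
    kind-agrees (isPromoted _ (_ , c , saturates , _)) =
      AgreesOffB-resp V (erase d) c (sym (proj₂ (proj₂ (to (saturates?-correct N (π c) (erase d) c) saturates))))
                      (erase-agrees d)
    kind-agrees (isPlain _ _) = erase-agrees d

    kind-special-B : (κ : Kind d) → ∀ b → T (inB b ∧ lookup (colourOfKind κ) b) → Special d
    kind-special-B (isNamed d-named) _ _ = inj₁ d-named
    kind-special-B (isPromoted _ (small , _)) _ _ = inj₂ (small⇒¬infinite _ small)
    kind-special-B (isPlain _ _) b t = ⊥-elim (free⇒¬B (erase d) (erase-free d) b t)

    kind-special-finite : (κ : Kind d) → ¬ T (infinite? (π (colourOfKind κ))) → Special d
    kind-special-finite (isNamed d-named) _ = inj₁ d-named
    kind-special-finite (isPromoted _ (small , _)) _ = inj₂ (small⇒¬infinite _ small)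
    kind-special-finite (isPlain _ _) finite = inj₂ finite

  U≤V : U ≤ω[ B ] V
  U≤V = (λ a → (λ a∈B d u → kind-positive (kind d) a (from T-∧ (from inB⇔∈ a∈B , u))) ,
               (λ a∉B d → ⇔.sym (kind-agrees (kind d) a (from (T-not {inB a}) (a∉B ∘ to inB⇔∈))))) ,
        (λ b b∈B → Finite-⊆ (λ d u → kind-special-B (kind d) b (from T-∧ (from inB⇔∈ b∈B , u))) special-finite)

  Class : Colour k → D → Set
  Class c d = β d ≡ c

  named-colour : ∀ i (κ : Kind (g i)) → colourOfKind κ ≡ slotColour i
  named-colour i (isNamed (j , gj≡gi)) = cong slotColour (g-injective gj≡gi)
  named-colour i (isPromoted ¬named _) = ⊥-elim (¬named (i , refl))
  named-colour i (isPlain ¬named _) = ⊥-elim (¬named (i , refl))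

  slot-elements : ∀ c → AtLeast (Class c) (count c)
  slot-elements c = distinct (g ∘ encode count c) (encode-injective count c ∘ g-injective)
                             λ t → trans (named-colour _ (kind _)) (cong proj₁ (decode-encode count c t))

  infinite-class : ∀ {c} → π c ≡ ∞ → ¬ Finite (Class c)
  infinite-class {c} π≡∞ finite =
    agreeing-infinite c-free π≡∞ (Finite-⊆ (λ d → sort (kind d)) (Finite-∪ (Finite-range g) finite))
    where
      c-free : T (free? c)
      c-free = admissible c (subst (T ∘ infinite?) (sym π≡∞) tt)
      sort : ∀ {d} (κ : Kind d) → AgreesOffB V d c → Named d ⊎ colourOfKind κ ≡ c
      sort (isNamed d-named) _ = inj₁ d-named
      sort {d} (isPromoted _ (small , _)) agree =
        ⊥-elim (small⇒¬infinite _ small (subst (T ∘ infinite? ∘ π) (sym (erase-unique c-free agree))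
                                                 (subst (T ∘ infinite?) (sym π≡∞) tt)))
      sort (isPlain _ _) agree = inj₂ (erase-unique c-free agree)

  promotable-sat : ∀ {e d} → Sat D V (Promotable e) (extend d g) →
                   Σ (Colour k) λ c → T (saturates? N (π c) e c) × PositiveB V d c
  promotable-sat (_ , s) =
    let c , _ , s′ = to (⋁-sat (allColours k)) s ; saturates , positive = to (guard-sat _) s′
    in c , saturates , to (positiveB-sat c zero) positive

  small-class-named : ∀ {c m d} → π c ≡ fin m → m < N → (κ : Kind d) → colourOfKind κ ≡ c →
                      Σ (Fin (count c)) λ t → g (encode count c t) ≡ d
  small-class-named _ _ (isNamed (i , refl)) refl = proj₂ (decode count i) , cong g (encode-decode count i)
  small-class-named {c} π≡m m<N (isPromoted _ (_ , _ , saturates , _)) refl =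
    ⊥-elim (<-irrefl (fin-injective (trans (sym π≡m) full)) m<N)
    where
      full : π c ≡ fin N
      full = proj₁ (proj₂ (to (saturates?-correct N (π c) (erase _) c) saturates))
  small-class-named {d = d} π≡m m<N (isPlain ¬named ¬promote) refl
    with promotable-or-exempt (erase-free d) π≡m m<N d
  ... | inj₁ promotable =
    ⊥-elim (¬promote (subst (T ∘ small? N) (sym π≡m) (<⇒<ᵇ m<N) , promotable-sat {erase d} promotable))
  ... | inj₂ exempt = ⊥-elim (¬Exempt {erase d} ¬named (erase-agrees d) exempt)

  class-card : ∀ c → HasCard N (Class c) (π c)
  class-card c = on (π c) refl
    where
      on : ∀ x → π c ≡ x → HasCard N (Class c) x
      on ∞ π≡∞ = infinite-class π≡∞
      on (fin m) π≡m =
        Finite-⊆ (λ d β≡c → kind-special-finite (kind d) (subst (¬_ ∘ T ∘ infinite? ∘ π) (sym β≡c) (finite π≡m)))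
                 special-finite ,
        AtLeast-≤ (m⊓n≤m m N) (subst (AtLeast (Class c) ∘ finitePart) π≡m (slot-elements c)) ,
        λ m<N → subst (AtMost (Class c) ∘ finitePart) π≡m
                  (AtMost-range (g ∘ encode count c) λ d → small-class-named π≡m m<N (kind d))

  counts : ColourCounts N U π
  counts c = HasCard-resp (π c) (λ d β≡c → subst (HasColour U d) β≡c (hasColour λ _ → mk⇔ id id))
                                (λ d d∶c → HasColour-unique (hasColour λ _ → mk⇔ id id) d∶c)
                                (class-card c)

-- Characteristic sentences in M

module _ {k : ℕ} where

  SameColour : {D D′ : Set} → Val k D → Val k D′ → D → D′ → Set
  SameColour V V′ d d′ = ∀ a → V a d ⇔ V′ a d′

  Bisimilar : {D D′ : Set} → Val k D → Val k D′ → Set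
  Bisimilar {D} {D′} V V′ = (∀ d → Σ D′ λ d′ → SameColour V V′ d d′) × (∀ d′ → Σ D λ d → SameColour V V′ d d′)

  Bisimilar-sym : {D D′ : Set} {V : Val k D} {V′ : Val k D′} → Bisimilar V V′ → Bisimilar V′ V
  Bisimilar-sym (forth , back) = (λ d′ → let d , same = back d′ in d , ⇔.sym ∘ same) ,
                                 (λ d → let d′ , same = forth d in d′ , ⇔.sym ∘ same)

  M-invariant : ∀ {n} (φ : Fm M k n) {D D′ : Set} {V : Val k D} {V′ : Val k D′} → Bisimilar V V′ →
                ∀ {g g′} → (∀ i → SameColour V V′ (g i) (g′ i)) → Sat D V φ g → Sat D′ V′ φ g′
  M-invariant tt′ _ _ s = s
  M-invariant ff′ _ _ s = s
  M-invariant (atom a x) _ same s = to (same x a) s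
  M-invariant (natom a x) _ same s = s ∘ from (same x a)
  M-invariant (or φ ψ) bisim same = Data.Sum.map (M-invariant φ bisim same) (M-invariant ψ bisim same)
  M-invariant (and φ ψ) bisim same (s , t) = M-invariant φ bisim same s , M-invariant ψ bisim same t
  M-invariant (ex φ) bisim same (d , s) =
    let d′ , same′ = proj₁ bisim d in d′ , M-invariant φ bisim (λ { zero → same′ ; (suc i) → same i }) s
  M-invariant (all φ) bisim same s d′ =
    let d , same′ = proj₂ bisim d′ in M-invariant φ bisim (λ { zero → same′ ; (suc i) → same i }) (s d)

  M-invariant-sentence : (φ : Sentence M k) {D D′ : Set} {V : Val k D} {V′ : Val k D′} →
                         Bisimilar V V′ → Sat D V φ noVars → Sat D′ V′ φ noVars
  M-invariant-sentence φ bisim = M-invariant φ bisim λ ()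

  Realised : {D : Set} → Val k D → Colour k → Set
  Realised {D} V c = Σ D λ d → HasColour V d c

  Bisimilar-if-same-realised : LEM → {D D′ : Set} (V : Val k D) (V′ : Val k D′) →
                               (∀ c → Realised V c ⇔ Realised V′ c) → Bisimilar V V′
  Bisimilar-if-same-realised lem {D} {D′} V V′ same = forth , back
    where
      forth : ∀ d → Σ D′ (SameColour V V′ d)
      forth d = let d′ , hasColour d′∶c = to (same _) (d , colourOf-correct lem V d) in
        d′ , λ a → ⇔.trans (colour-at (colourOf-correct lem V d) a) (⇔.sym (d′∶c a))
      back : ∀ d′ → Σ D λ d → SameColour V V′ d d′
      back d′ = let d , hasColour d∶c = from (same _) (d′ , colourOf-correct lem V′ d′) in
        d , λ a → ⇔.trans (d∶c a) (⇔.sym (colour-at (colourOf-correct lem V′ d′) a))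

  Copies : {D : Set} (I : Set) → Val k D → Val k (D × I)
  Copies I V a (d , _) = V a d

  Copies-Bisimilar : {D I : Set} (V : Val k D) → I → Bisimilar V (Copies I V)
  Copies-Bisimilar V i = (λ d → (d , i) , λ _ → mk⇔ id id) , (λ (d , _) → d , λ _ → mk⇔ id id)

canonical-realised : ∀ {k} (r : Colour k → Card) c → Realised (Canonical.Val′ r) c ⇔ T (positive? (r c))
canonical-realised r c = mk⇔
  (λ (((_ , i) , below) , d∶c) → subst (T ∘ positive? ∘ r) (to (Canonical.HasColour-canonical r _) d∶c)
                                        (occupied _ below))
  (λ pos → let d = (c , 0) , first (r c) pos in d , from (Canonical.HasColour-canonical r d) refl)
  where
    occupied : ∀ x {i} → Canonical.Below r x i → T (positive? x)
    occupied ∞ _ = tt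
    occupied (fin (suc _)) _ = tt
    first : ∀ x → T (positive? x) → Canonical.Below r x 0
    first ∞ _ = tt
    first (fin (suc _)) _ = s≤s z≤n

eval-sentence-M : LEM → ∀ {k} (φ : Sentence M k) {D : Set} {V : Val k D} {r : Colour k → Card} →
                  (∀ c → Realised V c ⇔ T (positive? (r c))) → Sat D V φ noVars ⇔ T (eval φ (initial r))
eval-sentence-M lem φ {V = V} {r} realised = mk⇔
  (to canonical-sat ∘ M-invariant-sentence φ bisim)
  (M-invariant-sentence φ (Bisimilar-sym bisim) ∘ from canonical-sat)
  where
    open Canonical r using (Val′; canonical-counts)
    bisim : Bisimilar V Val′
    bisim = Bisimilar-if-same-realised lem V Val′ λ c → ⇔.trans (realised c) (⇔.sym (canonical-realised r c))
    canonical-sat : Sat _ Val′ φ noVars ⇔ T (eval φ (initial r))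
    canonical-sat = eval-sentence lem φ ≤-refl (canonical-counts (depth φ))

module CharacteristicM {k : ℕ} (B : Subset k) (π : Colour k → Card) where
  open ColourFormulas B
  open Formulas {M}
  open Connectives {M} {k}

  Witnessed : Colour k → Sentence M k
  Witnessed c = ex (and (positiveB c zero) (agreeOffB c zero))

  χM : Sentence M k
  χM = and (⋀ (allColours k) λ c → when (positive? (π c)) (Witnessed c))
           (all (⋁ (allColours k) λ e → guard (positive? (π e) ∧ free? e) (agreeOffB e zero)))

  χM-SynCont : SynCont B χM
  χM-SynCont = and (⋀-SynCont B (allColours k) λ c → when-SynCont B _ λ _ →
                      ex (and (positiveB-SynCont c zero) (base (agreeOffB-NoB c zero))))
                   (base (all (⋁-NoB B (allColours k) λ e → guard-NoB B _ λ _ → agreeOffB-NoB e zero)))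

  module _ {D : Set} {V : Val k D} where

    χM-sat : Sat D V χM noVars ⇔
             ((∀ c → T (positive? (π c)) → Σ D λ d → PositiveB V d c × AgreesOffB V d c) ×
              (∀ d → Σ (Colour k) λ e → T (positive? (π e)) × T (free? e) × AgreesOffB V d e))
    χM-sat = mk⇔
      (λ (witnessed , covered) →
         (λ c pos → let d , p , a = to (when-sat _) (to (⋀-sat (allColours k)) witnessed c (∈-allColours c)) pos
                    in d , to (positiveB-sat c zero) p , to (agreeOffB-sat c zero) a) ,
         (λ d → let e , _ , s = to (⋁-sat (allColours k)) (covered d) ; t , a = to (guard-sat _) s
                    pos , e-free = to T-∧ t
                in e , pos , e-free , to (agreeOffB-sat e zero) a))
      (λ (witnessed , covered) →
         from (⋀-sat (allColours k)) (λ c _ → from (when-sat _) λ pos →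
           let d , p , a = witnessed c pos in d , from (positiveB-sat c zero) p , from (agreeOffB-sat c zero) a) ,
         (λ d → let e , pos , e-free , a = covered d in
                from (⋁-sat (allColours k))
                     (e , ∈-allColours e ,
                      from (guard-sat _) (from T-∧ (pos , e-free) , from (agreeOffB-sat e zero) a))))

module CharacteristicMSound (lem : LEM) {k : ℕ} (B : Subset k) (π : Colour k → Card)
         {D : Set} {V : Val k D} (sat : Sat D V (CharacteristicM.χM B π) noVars) where
  open Classical lem
  open CharacteristicM B π
  open ColourFormulas B
  open Erasure lem V

  witness : ∀ c → T (positive? (π c)) → D
  witness c pos = proj₁ (proj₁ (to χM-sat sat) c pos)

  witness-positive : ∀ c pos → PositiveB V (witness c pos) c
  witness-positive c pos = proj₁ (proj₂ (proj₁ (to χM-sat sat) c pos))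

  witness-agrees : ∀ c pos → AgreesOffB V (witness c pos) c
  witness-agrees c pos = proj₂ (proj₂ (proj₁ (to χM-sat sat) c pos))

  erase-realised : ∀ d → T (positive? (π (erase d)))
  erase-realised d = let e , pos , e-free , agree = proj₂ (to χM-sat sat) d in
    subst (T ∘ positive? ∘ π) (sym (erase-unique e-free agree)) pos

  -- The copy (d , just c) of a witness of c takes colour c, while (d , nothing) keeps the colour of d
  -- without its B-letters, so promoting witnesses does not hide any colour of V.
  D′ : Set
  D′ = D × Maybe (Colour k)

  V′ : Val k D′
  V′ = Copies (Maybe (Colour k)) V

  Chosen : Colour k → D → Set
  Chosen c d = Σ (T (positive? (π c))) λ pos → witness c pos ≡ d

  colourFor : ∀ d c → Dec (Chosen c d) → Colour k
  colourFor d c (yes _) = c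
  colourFor d c (no _) = erase d

  β : D′ → Colour k
  β (d , nothing) = erase d
  β (d , just c) = colourFor d c (decide (Chosen c d))

  U : Val k D′
  U a x = T (lookup (β x) a)

  Promoted : D′ → Set
  Promoted x = Σ (Colour k) λ c → c ∈ allColours k × (Chosen c (proj₁ x) × proj₂ x ≡ just c)

  promoted-finite : Finite Promoted
  promoted-finite = Finite-⋃ (allColours k) λ c → case T? (positive? (π c)) of λ
    { (yes pos) → (witness c pos , just c) ∷ [] ,
                  λ { _ ((pos′ , refl) , refl) → here (cong (λ p → witness c p , just c) (T-irrelevant pos′ pos)) }
    ; (no ¬pos) → [] , λ _ ((pos , _) , _) → ⊥-elim (¬pos pos) }

  module _ {d : D} {c : Colour k} where

    colourFor-positive : (chosen? : Dec (Chosen c d)) → PositiveB V d (colourFor d c chosen?)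
    colourFor-positive (yes (pos , refl)) = witness-positive c pos
    colourFor-positive (no _) a t = ⊥-elim (free⇒¬B (erase d) (erase-free d) a t)

    colourFor-agrees : (chosen? : Dec (Chosen c d)) → AgreesOffB V d (colourFor d c chosen?)
    colourFor-agrees (yes (pos , refl)) = witness-agrees c pos
    colourFor-agrees (no _) = erase-agrees d

    colourFor-promoted : (chosen? : Dec (Chosen c d)) →
                         ∀ b → T (inB b ∧ lookup (colourFor d c chosen?) b) → Promoted (d , just c)
    colourFor-promoted (yes chosen) _ _ = c , ∈-allColours c , chosen , refl
    colourFor-promoted (no _) b t = ⊥-elim (free⇒¬B (erase d) (erase-free d) b t)

    colourFor-realised : (chosen? : Dec (Chosen c d)) → T (positive? (π (colourFor d c chosen?)))
    colourFor-realised (yes (pos , _)) = pos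
    colourFor-realised (no _) = erase-realised d

  β-positive : ∀ x → PositiveB V (proj₁ x) (β x)
  β-positive (d , nothing) a t = ⊥-elim (free⇒¬B (erase d) (erase-free d) a t)
  β-positive (d , just c) = colourFor-positive (decide (Chosen c d))

  β-agrees : ∀ x → AgreesOffB V (proj₁ x) (β x)
  β-agrees (d , nothing) = erase-agrees d
  β-agrees (d , just c) = colourFor-agrees (decide (Chosen c d))

  β-promoted : ∀ x b → T (inB b ∧ lookup (β x) b) → Promoted x
  β-promoted (d , nothing) b t = ⊥-elim (free⇒¬B (erase d) (erase-free d) b t)
  β-promoted (d , just c) = colourFor-promoted (decide (Chosen c d))

  β-realised : ∀ x → T (positive? (π (β x)))
  β-realised (d , nothing) = erase-realised d
  β-realised (d , just c) = colourFor-realised (decide (Chosen c d))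

  β-witness : ∀ c pos → β (witness c pos , just c) ≡ c
  β-witness c pos with decide (Chosen c (witness c pos))
  ... | yes _ = refl
  ... | no ¬chosen = ⊥-elim (¬chosen (pos , refl))

  U≤V′ : U ≤ω[ B ] V′
  U≤V′ = (λ a → (λ a∈B x u → β-positive x a (from T-∧ (from inB⇔∈ a∈B , u))) ,
                (λ a∉B x → ⇔.sym (β-agrees x a (from (T-not {inB a}) (a∉B ∘ to inB⇔∈))))) ,
         (λ b b∈B → Finite-⊆ (λ x u → β-promoted x b (from T-∧ (from inB⇔∈ b∈B , u))) promoted-finite)

  U-realised : ∀ c → Realised U c ⇔ T (positive? (π c))
  U-realised c = mk⇔
    (λ (x , x∶c) → subst (T ∘ positive? ∘ π) (HasColour-unique (hasColour λ _ → mk⇔ id id) x∶c) (β-realised x))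
    (λ pos → (witness c pos , just c) , subst (HasColour U _) (β-witness c pos) (hasColour λ _ → mk⇔ id id))

  χM-sound : (φ : Sentence M k) → Monotone B φ → T (eval φ (initial π)) → Sat D V φ noVars
  χM-sound φ monotone φ-holds =
    M-invariant-sentence φ (Bisimilar-sym (Copies-Bisimilar V nothing))
      (monotone D′ U V′ noVars (from (eval-sentence-M lem φ U-realised) φ-holds) (proj₁ U≤V′))

presence : List Card
presence = ∞ ∷ fin 0 ∷ []

module CharacteristicMComplete (lem : LEM) {k : ℕ} (B : Subset k) (φ : Sentence M k) (continuous : Continuous B φ)
         {D : Set} {V : Val k D} (sat : Sat D V φ noVars) where
  open Classical lem
  open CharacteristicM
  open ColourFormulas B

  V′ : Val k (D × ℕ)
  V′ = Copies ℕ V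

  copies : Bisimilar V V′
  copies = Copies-Bisimilar V 0

  support : Σ (Val k (D × ℕ)) λ U → U ≤ω[ B ] V′ × Sat (D × ℕ) U φ noVars
  support = proj₂ continuous (D × ℕ) V′ noVars (M-invariant-sentence φ copies sat)

  U : Val k (D × ℕ)
  U = proj₁ support

  U≤V′ : U ≤ω[ B ] V′
  U≤V′ = proj₁ (proj₂ support)

  open Refinement U≤V′

  occurrence : Colour k → Card
  occurrence c with decide (Realised U c)
  ... | yes _ = ∞
  ... | no _ = fin 0

  occurrence-realised : ∀ c → Realised U c ⇔ T (positive? (occurrence c))
  occurrence-realised c with decide (Realised U c)
  ... | yes realised = mk⇔ _ λ _ → realised
  ... | no ¬realised = mk⇔ ¬realised λ ()

  occurrence∈presence : ∀ c → occurrence c ∈ presence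
  occurrence∈presence c with decide (Realised U c)
  ... | yes _ = here refl
  ... | no _ = there (here refl)

  π : Colour k → Card
  π = proj₁ (functions-complete k occurrence occurrence∈presence)

  π∈functions : π ∈ functions k presence
  π∈functions = proj₁ (proj₂ (functions-complete k occurrence occurrence∈presence))

  π-realised : ∀ c → Realised U c ⇔ T (positive? (π c))
  π-realised c = subst (λ x → Realised U c ⇔ T (positive? x))
                       (sym (proj₂ (proj₂ (functions-complete k occurrence occurrence∈presence)) c))
                       (occurrence-realised c)

  φ-holds : T (eval φ (initial π))
  φ-holds = to (eval-sentence-M lem φ π-realised) (proj₂ (proj₂ support))

  covered : ∀ x → Σ (Colour k) λ e → T (positive? (π e)) × T (free? e) × AgreesOffB V′ x e
  covered (d , _) = c , to (π-realised c) (y , y∶c) , c-free , colour-agrees y∶c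
    where
      -- A copy of d outside the finite B-support of U, so its U-colour is B-free.
      n : ℕ
      n = proj₁ (fresh-index (proj₁ BSupport-finite))
      y : D × ℕ
      y = d , n
      c : Colour k
      c = colourOf lem U y
      y∶c : HasColour U y c
      y∶c = colourOf-correct lem U y
      c-free : T (free? c)
      c-free = decidable-stable (T? _) λ nonfree →
        proj₂ (fresh-index (proj₁ BSupport-finite)) d (proj₂ BSupport-finite y (nonfree-BSupport c nonfree y∶c))

  χM-holds : Sat D V (χM B π) noVars
  χM-holds = M-invariant-sentence (χM B π) (Bisimilar-sym copies) (from (χM-sat B π) (witnessed , covered))
    where
      witnessed : ∀ c → T (positive? (π c)) → Σ (D × ℕ) λ x → PositiveB V′ x c × AgreesOffB V′ x c
      witnessed c pos = let x , x∶c = from (π-realised c) pos in x , colour-positive x∶c , colour-agrees x∶c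

-- The normal form

module NormalForm {k : ℕ} (B : Subset k) where
  open ColourFormulas B
  open Connectives

  admissible? : (Colour k → Card) → Bool
  admissible? π = allᵇ (λ c → not (infinite? (π c)) ∨ free? c) (allColours k)

  Ψ : ∀ L → Sentence L k → Sentence L k
  Ψ M φ = ⋁ (functions k presence) λ π → guard (eval φ (initial π)) (CharacteristicM.χM B π)
  Ψ MEinf φ = ⋁ (functions k (cards≤ (depth φ))) λ π →
    guard (admissible? π ∧ eval φ (initial π)) (Characteristic.χ B (depth φ) π)

  Ψ-SynCont : ∀ L (φ : Sentence L k) → SynCont B (Ψ L φ)
  Ψ-SynCont M φ = ⋁-SynCont B (functions k presence) λ π →
    guard-SynCont B _ λ _ → CharacteristicM.χM-SynCont B π
  Ψ-SynCont MEinf φ = ⋁-SynCont B (functions k (cards≤ (depth φ))) λ π →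
    guard-SynCont B _ λ _ → Characteristic.χ-SynCont B (depth φ) π

  module _ (lem : LEM) where

    Ψ-sound : ∀ L (φ : Sentence L k) → Monotone B φ → ∀ D V → Sat D V (Ψ L φ) noVars → Sat D V φ noVars
    Ψ-sound M φ monotone D V s =
      let π , _ , s′ = to (⋁-sat (functions k presence)) s ; φ-holds , χ-holds = to (guard-sat _) s′ in
      CharacteristicMSound.χM-sound lem B π χ-holds φ monotone φ-holds
    Ψ-sound MEinf φ monotone D V s =
      let π , _ , s′ = to (⋁-sat (functions k (cards≤ (depth φ)))) s ; t , χ-holds = to (guard-sat _) s′
          admissible , φ-holds = to T-∧ t
          open CharacteristicSound lem B (depth φ) π
                 (λ c → to T-⇒ (to (T-all-complete ∈-allColours _) admissible c)) χ-holds
      in monotone D U V noVars (from (eval-sentence lem φ ≤-refl counts) φ-holds) (proj₁ U≤V)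

    Ψ-complete : ∀ L (φ : Sentence L k) → Continuous B φ →
                 ∀ D V → Sat D V φ noVars → Sat D V (Ψ L φ) noVars
    Ψ-complete M φ continuous D V s = let open CharacteristicMComplete lem B φ continuous s in
      from (⋁-sat (functions k presence)) (π , π∈functions , from (guard-sat _) (φ-holds , χM-holds))
    Ψ-complete MEinf φ continuous D V s with proj₂ continuous D V noVars s
    ... | U , U≤V , U-sat with ColourCounts-exists lem (depth φ) U
    ... | r , r-capped , r-counts with functions-complete k r r-capped
    ... | π , π∈functions , π≗r = from (⋁-sat (functions k (cards≤ (depth φ))))
          (π , π∈functions , from (guard-sat _) (from T-∧ (admissible?-holds , φ-holds) , χ-sat))
      where
        counts : ColourCounts (depth φ) U π
        counts = ColourCounts-cong (sym ∘ π≗r) r-counts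
        open CharacteristicComplete lem B (depth φ) π (functions-sound k π∈functions) U≤V counts
        φ-holds : T (eval φ (initial π))
        φ-holds = to (eval-sentence lem φ ≤-refl counts) U-sat
        admissible?-holds : T (admissible? π)
        admissible?-holds = from (T-all-complete ∈-allColours _) λ c → from T-⇒ (admissible c)

    Ψ-equivalent : ∀ L (φ : Sentence L k) → Continuous B φ → Equivalent φ (Ψ L φ)
    Ψ-equivalent L φ continuous D V = mk⇔ (Ψ-complete L φ continuous D V) (Ψ-sound L φ (proj₁ continuous) D V)

module _ {L : Lang} {k : ℕ} {φ ψ : Sentence L k} (φ≈ψ : Equivalent φ ψ) where

  Equivalent-at : ∀ D V (g : Fin 0 → D) → Sat D V φ g ⇔ Sat D V ψ g
  Equivalent-at D V g = mk⇔ (Sat-cong ψ (λ ()) ∘ to (φ≈ψ D V) ∘ Sat-cong φ (λ ()))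
                            (Sat-cong φ (λ ()) ∘ from (φ≈ψ D V) ∘ Sat-cong ψ (λ ()))

  Continuous-resp-Equivalent : {B : Subset k} → Continuous B ψ → Continuous B φ
  Continuous-resp-Equivalent (monotone , support) =
    (λ D V V′ g s V≤V′ → from (Equivalent-at D V′ g) (monotone D V V′ g (to (Equivalent-at D V g) s) V≤V′)) ,
    (λ D V g s → let U , U≤V , t = support D V g (to (Equivalent-at D V g) s)
                 in U , U≤V , from (Equivalent-at D U g) t)

theorem5p6 : (L : Lang) (k : ℕ) (B : Subset k) →
    (LEM → (φ : Sentence L k) →
      Continuous B φ ⇔ Σ (Sentence L k) (λ ψ → SynCont B ψ × Equivalent φ ψ))
    × Σ (Sentence L k → Bool)
        (λ f → LEM → (φ : Sentence L k) → (f φ ≡ true) ⇔ Continuous B φ)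
theorem5p6 L k B =
  (λ lem φ → mk⇔ (λ continuous → Ψ L φ , Ψ-SynCont L φ , Ψ-equivalent lem L φ continuous)
                 (λ (ψ , ψ-SynCont , φ≈ψ) →
                    Continuous-resp-Equivalent {φ = φ} {ψ} φ≈ψ (SynCont⇒Continuous lem ψ-SynCont))) ,
  (λ φ → equivalent? φ (Ψ L φ)) ,
  (λ lem φ → mk⇔
    (λ check → Continuous-resp-Equivalent {φ = φ} {Ψ L φ} (equivalent?-sound lem φ (Ψ L φ) (from T-≡ check))
                                                          (SynCont⇒Continuous lem (Ψ-SynCont L φ)))
    (λ continuous → to T-≡ (equivalent?-complete lem φ (Ψ L φ) (Ψ-equivalent lem L φ continuous))))
  where
    open NormalForm B
    open SyntacticContinuity B
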